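{- The ordinal interpretation $\mathfrak o$ is an interpretation from $\mathsf{HA}$ to $\mathbb{T}$; that is, $\mathbb{T}\vdash\sigma^{\mathfrak o}$ for every axiom $\sigma$ of $\mathsf{HA}$.
   Context: $\mathsf{HA}$: intuitionistic arithmetic in $\{0,S,+,\cdot\}$ with $Sx=Sy\to x=y$, $x=0\lor\exists y(x=Sy)$, recursion equations for $+,\cdot$, and induction for all formulas. $\mathbb{T}$: intuitionistic set theory with Extensionality, Pairing, Union, Binary Intersection, Set Induction for all formulas, and $V=\mathrm{Fin}$ (every set is in bijection with some $n\in\omega$). Ordinals are transitive sets of transitive sets; $\omega$ is the class of ordinals $\alpha$ such that each element of $\alpha\cup\{\alpha\}$ is $\varnothing$ or $\gamma\cup\{\gamma\}$ for an ordinal $\gamma$. $\mathfrak o$: domain $x\in\omega$; $0^{\mathfrak o}=\varnothing$, $S^{\mathfrak o}(x)=x\cup\{x\}$, and $+,\cdot$ are interpreted by addition and multiplication on $\omega$ (defined by primitive recursion); quantifiers are relativized to $\omega$. -}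

module Defs where

open import Data.Nat using (ℕ; zero; suc)
open import Data.Fin using (Fin; zero; suc)
open import Data.List using (List; []; _∷_; map)
open import Data.List.Membership.Propositional using (_∈_)
open import Data.List.Relation.Unary.All using (All)
open import Data.Product using (Σ; _×_)

infix  8 _∈ˢ_ _≐_
infixr 7 _∧_
infixr 6 _∨_
infixr 5 _⇒_ _⇔_

data SFm (n : ℕ) : Set where
  _∈ˢ_ _≐_    : Fin n → Fin n → SFm n
  ⊥̇           : SFm n
  _∧_ _∨_ _⇒_ : SFm n → SFm n → SFm n
  ∀̇ ∃̇          : SFm (suc n) → SFm n

¬̇_ : ∀ {n} → SFm n → SFm n
¬̇ φ = φ ⇒ ⊥̇

_⇔_ : ∀ {n} → SFm n → SFm n → SFm n
φ ⇔ ψ = (φ ⇒ ψ) ∧ (ψ ⇒ φ)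

-- binder notation: the bound variable is 'zero', outer variables are lifted by 'suc'
∀[_] : ∀ {n} → (Fin (suc n) → SFm (suc n)) → SFm n
∀[ f ] = ∀̇ (f zero)

∃[_] : ∀ {n} → (Fin (suc n) → SFm (suc n)) → SFm n
∃[ f ] = ∃̇ (f zero)

ext : ∀ {n m} → (Fin n → Fin m) → Fin (suc n) → Fin (suc m)
ext ρ zero    = zero
ext ρ (suc i) = suc (ρ i)

ren : ∀ {n m} → (Fin n → Fin m) → SFm n → SFm m
ren ρ (x ∈ˢ y) = ρ x ∈ˢ ρ y
ren ρ (x ≐ y)  = ρ x ≐ ρ y
ren ρ ⊥̇        = ⊥̇
ren ρ (φ ∧ ψ)  = ren ρ φ ∧ ren ρ ψ
ren ρ (φ ∨ ψ)  = ren ρ φ ∨ ren ρ ψ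
ren ρ (φ ⇒ ψ)  = ren ρ φ ⇒ ren ρ ψ
ren ρ (∀̇ φ)    = ∀̇ (ren (ext ρ) φ)
ren ρ (∃̇ φ)    = ∃̇ (ren (ext ρ) φ)

wk : ∀ {n} → SFm n → SFm (suc n)
wk = ren suc

inst : ∀ {n} → Fin n → Fin (suc n) → Fin n
inst x zero    = x
inst x (suc i) = i

_[_] : ∀ {n} → SFm (suc n) → Fin n → SFm n
φ [ x ] = ren (inst x) φ

closeS : ∀ {n} → SFm n → SFm 0
closeS {zero}  φ = φ
closeS {suc n} φ = closeS (∀̇ φ)

infix 3 _⊢_

data _⊢_ : ∀ {n} → List (SFm n) → SFm n → Set where
  hyp   : ∀ {n} {Γ : List (SFm n)} {φ} → φ ∈ Γ → Γ ⊢ φ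
  ⊥E    : ∀ {n} {Γ : List (SFm n)} {φ} → Γ ⊢ ⊥̇ → Γ ⊢ φ
  ∧I    : ∀ {n} {Γ : List (SFm n)} {φ ψ} → Γ ⊢ φ → Γ ⊢ ψ → Γ ⊢ φ ∧ ψ
  ∧E₁   : ∀ {n} {Γ : List (SFm n)} {φ ψ} → Γ ⊢ φ ∧ ψ → Γ ⊢ φ
  ∧E₂   : ∀ {n} {Γ : List (SFm n)} {φ ψ} → Γ ⊢ φ ∧ ψ → Γ ⊢ ψ
  ∨I₁   : ∀ {n} {Γ : List (SFm n)} {φ ψ} → Γ ⊢ φ → Γ ⊢ φ ∨ ψ
  ∨I₂   : ∀ {n} {Γ : List (SFm n)} {φ ψ} → Γ ⊢ ψ → Γ ⊢ φ ∨ ψ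
  ∨E    : ∀ {n} {Γ : List (SFm n)} {φ ψ χ} →
          Γ ⊢ φ ∨ ψ → φ ∷ Γ ⊢ χ → ψ ∷ Γ ⊢ χ → Γ ⊢ χ
  ⇒I    : ∀ {n} {Γ : List (SFm n)} {φ ψ} → φ ∷ Γ ⊢ ψ → Γ ⊢ φ ⇒ ψ
  ⇒E    : ∀ {n} {Γ : List (SFm n)} {φ ψ} → Γ ⊢ φ ⇒ ψ → Γ ⊢ φ → Γ ⊢ ψ
  ∀I    : ∀ {n} {Γ : List (SFm n)} {φ} → map wk Γ ⊢ φ → Γ ⊢ ∀̇ φ
  ∀E    : ∀ {n} {Γ : List (SFm n)} {φ} → Γ ⊢ ∀̇ φ → (x : Fin n) → Γ ⊢ φ [ x ]
  ∃I    : ∀ {n} {Γ : List (SFm n)} {φ} → (x : Fin n) → Γ ⊢ φ [ x ] → Γ ⊢ ∃̇ φ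
  ∃E    : ∀ {n} {Γ : List (SFm n)} {φ ψ} →
          Γ ⊢ ∃̇ φ → φ ∷ map wk Γ ⊢ wk ψ → Γ ⊢ ψ
  ≐refl : ∀ {n} {Γ : List (SFm n)} (x : Fin n) → Γ ⊢ x ≐ x
  ≐subst : ∀ {n} {Γ : List (SFm n)} (φ : SFm (suc n)) {x y : Fin n} →
          Γ ⊢ x ≐ y → Γ ⊢ φ [ x ] → Γ ⊢ φ [ y ]

emb : ∀ {k} → Fin 0 → Fin k
emb ()

-- Derivability of a sentence from a theory (set of sentences).
-- Working with k extra free variables gives the usual (nonempty-domain)
-- first-order logic.
_⊢ᵀ_ : (SFm 0 → Set) → SFm 0 → Set
Ax ⊢ᵀ σ = Σ ℕ λ k → Σ (List (SFm 0)) λ Γ →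
            All Ax Γ × (map (ren (emb {k})) Γ ⊢ ren (emb {k}) σ)

Empty : ∀ {n} → Fin n → SFm n
Empty x = ∀[ (λ z → ¬̇ (z ∈ˢ suc x)) ]

Trans : ∀ {n} → Fin n → SFm n
Trans x = ∀[ (λ y → y ∈ˢ suc x ⇒ ∀[ (λ z → z ∈ˢ suc y ⇒ z ∈ˢ suc (suc x)) ]) ]

Ord : ∀ {n} → Fin n → SFm n
Ord x = Trans x ∧ ∀[ (λ y → y ∈ˢ suc x ⇒ Trans y) ]

IsSuc : ∀ {n} → Fin n → Fin n → SFm n
IsSuc x y = ∀[ (λ z → z ∈ˢ suc y ⇔ (z ∈ˢ suc x ∨ z ≐ suc x)) ]

Nat : ∀ {n} → Fin n → SFm n
Nat x = Ord x ∧ ∀[ (λ y → (y ∈ˢ suc x ∨ y ≐ suc x) ⇒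
          (Empty y ∨ ∃[ (λ g → Ord g ∧ IsSuc g (suc y)) ])) ]

Sing : ∀ {n} → Fin n → Fin n → SFm n
Sing w a = ∀[ (λ v → v ∈ˢ suc w ⇔ v ≐ suc a) ]

Doub : ∀ {n} → Fin n → Fin n → Fin n → SFm n
Doub w a b = ∀[ (λ v → v ∈ˢ suc w ⇔ (v ≐ suc a ∨ v ≐ suc b)) ]

OPair : ∀ {n} → Fin n → Fin n → Fin n → SFm n
OPair p a b = ∀[ (λ w → w ∈ˢ suc p ⇔ (Sing w (suc a) ∨ Doub w (suc a) (suc b))) ]

Holds : ∀ {n} → Fin n → Fin n → Fin n → SFm n
Holds f a b = ∃[ (λ p → OPair p (suc a) (suc b) ∧ p ∈ˢ suc f) ]

Functional : ∀ {n} → Fin n → SFm n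
Functional f = ∀[ (λ k → ∀[ (λ v → ∀[ (λ w →
  Holds (suc (suc (suc f))) (suc (suc k)) (suc v) ⇒
  Holds (suc (suc (suc f))) (suc (suc k)) w ⇒ suc v ≐ w) ]) ]) ]

Injective : ∀ {n} → Fin n → SFm n
Injective f = ∀[ (λ a → ∀[ (λ b → ∀[ (λ v →
  Holds (suc (suc (suc f))) (suc (suc a)) v ⇒
  Holds (suc (suc (suc f))) (suc b) v ⇒ suc (suc a) ≐ suc b) ]) ]) ]

-- z = x + y, addition on ω defined by primitive recursion:
-- there is a (finite) function f with f(0) = x, f(k ∪ {k}) = f(k) ∪ {f(k)}
-- for k ∈ y, and f(y) = z.
AddF : ∀ {n} → Fin n → Fin n → Fin n → SFm n
AddF x y z = ∃[ (λ f →
    Functional f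
  ∧ ∀[ (λ e → Empty e ⇒ Holds (suc f) e (suc (suc x))) ]
  ∧ ∀[ (λ k → k ∈ˢ suc (suc y) ⇒ ∀[ (λ k₁ → IsSuc (suc k) k₁ ⇒
       ∀[ (λ v → Holds (suc (suc (suc f))) (suc (suc k)) v ⇒
         ∀[ (λ v₁ → IsSuc (suc v) v₁ ⇒
           Holds (suc (suc (suc (suc f)))) (suc (suc k₁)) v₁) ]) ]) ]) ]
  ∧ Holds f (suc y) (suc z)) ]

-- z = x · y, multiplication on ω defined by primitive recursion:
-- f(0) = 0, f(k ∪ {k}) = f(k) + x for k ∈ y, and f(y) = z.
MulF : ∀ {n} → Fin n → Fin n → Fin n → SFm n
MulF x y z = ∃[ (λ f →
    Functional f
  ∧ ∀[ (λ e → Empty e ⇒ Holds (suc f) e e) ]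
  ∧ ∀[ (λ k → k ∈ˢ suc (suc y) ⇒ ∀[ (λ k₁ → IsSuc (suc k) k₁ ⇒
       ∀[ (λ v → Holds (suc (suc (suc f))) (suc (suc k)) v ⇒
         ∀[ (λ v₁ → AddF (suc v) (suc (suc (suc (suc (suc x))))) v₁ ⇒
           Holds (suc (suc (suc (suc f)))) (suc (suc k₁)) v₁) ]) ]) ]) ]
  ∧ Holds f (suc y) (suc z)) ]

Bij : ∀ {n} → Fin n → Fin n → Fin n → SFm n
Bij f x m =
    ∀[ (λ p → p ∈ˢ suc f ⇒ ∃[ (λ a → a ∈ˢ suc (suc x) ∧
        ∃[ (λ b → b ∈ˢ suc (suc (suc m)) ∧ OPair (suc (suc p)) (suc a) b) ]) ]) ]
  ∧ ∀[ (λ a → a ∈ˢ suc x ⇒ ∃[ (λ b → b ∈ˢ suc (suc m) ∧ Holds (suc (suc f)) (suc a) b) ]) ]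
  ∧ ∀[ (λ b → b ∈ˢ suc m ⇒ ∃[ (λ a → a ∈ˢ suc (suc x) ∧ Holds (suc (suc f)) a (suc b)) ]) ]
  ∧ Functional f
  ∧ Injective f

-- renaming used in Set Induction: φ(y) under binders ∀x ∀y
indRen : ∀ {n} → Fin (suc n) → Fin (suc (suc n))
indRen zero    = zero
indRen (suc i) = suc (suc i)

data TAx : SFm 0 → Set where
  extensionality : TAx (∀[ (λ x → ∀[ (λ y →
      ∀[ (λ z → z ∈ˢ suc (suc x) ⇔ z ∈ˢ suc y) ] ⇒ suc x ≐ y) ]) ])
  pairing : TAx (∀[ (λ x → ∀[ (λ y → ∃[ (λ p → ∀[ (λ z →
      z ∈ˢ suc p ⇔ (z ≐ suc (suc (suc x)) ∨ z ≐ suc (suc y))) ]) ]) ]) ])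
  union : TAx (∀[ (λ x → ∃[ (λ u → ∀[ (λ z →
      z ∈ˢ suc u ⇔ ∃[ (λ w → w ∈ˢ suc (suc (suc x)) ∧ suc z ∈ˢ w) ]) ]) ]) ])
  intersection : TAx (∀[ (λ x → ∀[ (λ y → ∃[ (λ i → ∀[ (λ z →
      z ∈ˢ suc i ⇔ (z ∈ˢ suc (suc (suc x)) ∧ z ∈ˢ suc (suc y))) ]) ]) ]) ])
  setInduction : ∀ {n} (φ : SFm (suc n)) →
    TAx (closeS (∀̇ (∀̇ (zero ∈ˢ suc zero ⇒ ren indRen φ) ⇒ φ) ⇒ ∀̇ φ))
  finiteness : TAx (∀[ (λ x → ∃[ (λ m → Nat m ∧ ∃[ (λ f → Bij f (suc (suc x)) (suc m)) ]) ]) ])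

infix  8 _≡ᵃ_
infixl 10 _⊕_
infixl 11 _⊗_
infixr 7 _∧ᵃ_
infixr 6 _∨ᵃ_
infixr 5 _⇒ᵃ_

data ATm (n : ℕ) : Set where
  var     : Fin n → ATm n
  𝟎       : ATm n
  𝐒       : ATm n → ATm n
  _⊕_ _⊗_ : ATm n → ATm n → ATm n

data AFm (n : ℕ) : Set where
  _≡ᵃ_          : ATm n → ATm n → AFm n
  ⊥ᵃ            : AFm n
  _∧ᵃ_ _∨ᵃ_ _⇒ᵃ_ : AFm n → AFm n → AFm n
  ∀ᵃ ∃ᵃ          : AFm (suc n) → AFm n

renT : ∀ {n m} → (Fin n → Fin m) → ATm n → ATm m
renT ρ (var i) = var (ρ i)
renT ρ 𝟎       = 𝟎
renT ρ (𝐒 t)   = 𝐒 (renT ρ t)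
renT ρ (t ⊕ s) = renT ρ t ⊕ renT ρ s
renT ρ (t ⊗ s) = renT ρ t ⊗ renT ρ s

extT : ∀ {n m} → (Fin n → ATm m) → Fin (suc n) → ATm (suc m)
extT σ zero    = var zero
extT σ (suc i) = renT suc (σ i)

subT : ∀ {n m} → (Fin n → ATm m) → ATm n → ATm m
subT σ (var i) = σ i
subT σ 𝟎       = 𝟎
subT σ (𝐒 t)   = 𝐒 (subT σ t)
subT σ (t ⊕ s) = subT σ t ⊕ subT σ s
subT σ (t ⊗ s) = subT σ t ⊗ subT σ s

subA : ∀ {n m} → (Fin n → ATm m) → AFm n → AFm m
subA σ (t ≡ᵃ s) = subT σ t ≡ᵃ subT σ s
subA σ ⊥ᵃ       = ⊥ᵃ
subA σ (φ ∧ᵃ ψ) = subA σ φ ∧ᵃ subA σ ψ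
subA σ (φ ∨ᵃ ψ) = subA σ φ ∨ᵃ subA σ ψ
subA σ (φ ⇒ᵃ ψ) = subA σ φ ⇒ᵃ subA σ ψ
subA σ (∀ᵃ φ)   = ∀ᵃ (subA (extT σ) φ)
subA σ (∃ᵃ φ)   = ∃ᵃ (subA (extT σ) φ)

closeA : ∀ {n} → AFm n → AFm 0
closeA {zero}  φ = φ
closeA {suc n} φ = closeA (∀ᵃ φ)

-- substitutions for the induction schema (variable 0 = induction variable)
σZero : ∀ {n} → Fin (suc n) → ATm n
σZero zero    = 𝟎
σZero (suc i) = var i

σSucc : ∀ {n} → Fin (suc n) → ATm (suc n)
σSucc zero    = 𝐒 (var zero)
σSucc (suc i) = var (suc i)

data HAAx : AFm 0 → Set where
  succInj : HAAx (∀ᵃ (∀ᵃ (𝐒 (var (suc zero)) ≡ᵃ 𝐒 (var zero) ⇒ᵃ var (suc zero) ≡ᵃ var zero)))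
  zeroOrSucc : HAAx (∀ᵃ (var zero ≡ᵃ 𝟎 ∨ᵃ ∃ᵃ (var (suc zero) ≡ᵃ 𝐒 (var zero))))
  addZero : HAAx (∀ᵃ (var zero ⊕ 𝟎 ≡ᵃ var zero))
  addSucc : HAAx (∀ᵃ (∀ᵃ (var (suc zero) ⊕ 𝐒 (var zero) ≡ᵃ 𝐒 (var (suc zero) ⊕ var zero))))
  mulZero : HAAx (∀ᵃ (var zero ⊗ 𝟎 ≡ᵃ 𝟎))
  mulSucc : HAAx (∀ᵃ (∀ᵃ (var (suc zero) ⊗ 𝐒 (var zero) ≡ᵃ var (suc zero) ⊗ var zero ⊕ var (suc zero))))
  induction : ∀ {n} (φ : AFm (suc n)) →
    HAAx (closeA ((subA σZero φ ∧ᵃ ∀ᵃ (φ ⇒ᵃ subA σSucc φ)) ⇒ᵃ ∀ᵃ φ))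

-- TmIs ρ t y : "y = (ρ-renamed t)^𝔬"  (terms are unnested)
TmIs : ∀ {n m} → (Fin n → Fin m) → ATm n → Fin m → SFm m
TmIs ρ (var i) y = y ≐ ρ i
TmIs ρ 𝟎       y = Empty y
TmIs ρ (𝐒 t)   y = ∃[ (λ u → Nat u ∧ TmIs (λ i → suc (ρ i)) t u ∧ IsSuc u (suc y)) ]
TmIs ρ (t ⊕ s) y = ∃[ (λ u → ∃[ (λ w → Nat (suc u) ∧ Nat w
                    ∧ TmIs (λ i → suc (suc (ρ i))) t (suc u)
                    ∧ TmIs (λ i → suc (suc (ρ i))) s w
                    ∧ AddF (suc u) w (suc (suc y))) ]) ]
TmIs ρ (t ⊗ s) y = ∃[ (λ u → ∃[ (λ w → Nat (suc u) ∧ Nat w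
                    ∧ TmIs (λ i → suc (suc (ρ i))) t (suc u)
                    ∧ TmIs (λ i → suc (suc (ρ i))) s w
                    ∧ MulF (suc u) w (suc (suc y))) ]) ]

⟦_⟧ᵒ : ∀ {n} → AFm n → SFm n
⟦ t ≡ᵃ s ⟧ᵒ = ∃[ (λ u → ∃[ (λ w → Nat (suc u) ∧ Nat w
                ∧ TmIs (λ i → suc (suc i)) t (suc u)
                ∧ TmIs (λ i → suc (suc i)) s w
                ∧ suc u ≐ w) ]) ]
⟦ ⊥ᵃ ⟧ᵒ      = ⊥̇
⟦ φ ∧ᵃ ψ ⟧ᵒ  = ⟦ φ ⟧ᵒ ∧ ⟦ ψ ⟧ᵒ
⟦ φ ∨ᵃ ψ ⟧ᵒ  = ⟦ φ ⟧ᵒ ∨ ⟦ ψ ⟧ᵒ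
⟦ φ ⇒ᵃ ψ ⟧ᵒ  = ⟦ φ ⟧ᵒ ⇒ ⟦ ψ ⟧ᵒ
⟦ ∀ᵃ φ ⟧ᵒ    = ∀̇ (Nat zero ⇒ ⟦ φ ⟧ᵒ)
⟦ ∃ᵃ φ ⟧ᵒ    = ∃̇ (Nat zero ∧ ⟦ φ ⟧ᵒ)

module Submission where

-- Addition and multiplication on ω
-- are primitive recursions along finite functions: for x, y ∈ ω a recursion function up to y exists
-- by set induction on y (the function for g ∪ {g} adjoins one pair to the function for g), which
-- yields the recursion equations, and addition is functional by a second set induction comparing
-- two such functions pointwise. HA induction for φ becomes set induction for x ∈ ω → φ^𝔬, as every
-- element of ω is ∅ or some g ∪ {g} with g ∈ x; a substitution lemma identifies φ^𝔬 at ∅ and at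
-- g ∪ {g} with (φ[0])^𝔬 and (φ[S x])^𝔬.

open import Defs
open import Data.Nat using (ℕ; zero; suc)
open import Data.Fin using (Fin; zero; suc)
open import Data.List using (List; []; _∷_; map)
open import Data.List.Membership.Propositional using (_∈_)
open import Data.List.Membership.Propositional.Properties using (∈-map⁺)
open import Data.List.Relation.Binary.Subset.Propositional using (_⊆_)
open import Data.List.Relation.Binary.Subset.Propositional.Properties using (map⁺; ∷⁺ʳ; ⊆-refl; xs⊆x∷xs)
open import Data.List.Relation.Unary.Any using (here; there)
open import Data.List.Relation.Unary.All using (All; []; _∷_)
open import Data.Product using (_×_; _,_)
open import Function using (_∘_; _∘′_; id)
open import Relation.Binary.PropositionalEquality
  using (_≡_; refl; sym; trans; cong; cong₂; subst; subst₂)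

variable
  n m k : ℕ
  Γ Δ : List (SFm n)
  A B C : SFm n

ext-cong : {ρ τ : Fin n → Fin m} → (∀ i → ρ i ≡ τ i) → ∀ i → ext ρ i ≡ ext τ i
ext-cong e zero    = refl
ext-cong e (suc i) = cong suc (e i)

ren-cong : {ρ τ : Fin n → Fin m} → (∀ i → ρ i ≡ τ i) → ∀ φ → ren ρ φ ≡ ren τ φ
ren-cong e (x ∈ˢ y) = cong₂ _∈ˢ_ (e x) (e y)
ren-cong e (x ≐ y)  = cong₂ _≐_ (e x) (e y)
ren-cong e ⊥̇        = refl
ren-cong e (φ ∧ ψ)  = cong₂ _∧_ (ren-cong e φ) (ren-cong e ψ)
ren-cong e (φ ∨ ψ)  = cong₂ _∨_ (ren-cong e φ) (ren-cong e ψ)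
ren-cong e (φ ⇒ ψ)  = cong₂ _⇒_ (ren-cong e φ) (ren-cong e ψ)
ren-cong e (∀̇ φ)    = cong ∀̇ (ren-cong (ext-cong e) φ)
ren-cong e (∃̇ φ)    = cong ∃̇ (ren-cong (ext-cong e) φ)

ren-∘ : (ρ : Fin m → Fin k) (τ : Fin n → Fin m) → ∀ φ → ren ρ (ren τ φ) ≡ ren (ρ ∘′ τ) φ
ren-∘ ρ τ (x ∈ˢ y) = refl
ren-∘ ρ τ (x ≐ y)  = refl
ren-∘ ρ τ ⊥̇        = refl
ren-∘ ρ τ (φ ∧ ψ)  = cong₂ _∧_ (ren-∘ ρ τ φ) (ren-∘ ρ τ ψ)
ren-∘ ρ τ (φ ∨ ψ)  = cong₂ _∨_ (ren-∘ ρ τ φ) (ren-∘ ρ τ ψ)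
ren-∘ ρ τ (φ ⇒ ψ)  = cong₂ _⇒_ (ren-∘ ρ τ φ) (ren-∘ ρ τ ψ)
ren-∘ ρ τ (∀̇ φ)    = cong ∀̇ (trans (ren-∘ (ext ρ) (ext τ) φ) (ren-cong (λ { zero → refl ; (suc i) → refl }) φ))
ren-∘ ρ τ (∃̇ φ)    = cong ∃̇ (trans (ren-∘ (ext ρ) (ext τ) φ) (ren-cong (λ { zero → refl ; (suc i) → refl }) φ))

ren-id : {ρ : Fin n → Fin n} → (∀ i → ρ i ≡ i) → ∀ φ → ren ρ φ ≡ φ
ren-id e φ = trans (ren-cong e φ) (ren-id′ φ)
  where
  ren-id′ : ∀ {n} (φ : SFm n) → ren id φ ≡ φ
  ren-id′ (x ∈ˢ y) = refl
  ren-id′ (x ≐ y)  = refl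
  ren-id′ ⊥̇        = refl
  ren-id′ (φ ∧ ψ)  = cong₂ _∧_ (ren-id′ φ) (ren-id′ ψ)
  ren-id′ (φ ∨ ψ)  = cong₂ _∨_ (ren-id′ φ) (ren-id′ ψ)
  ren-id′ (φ ⇒ ψ)  = cong₂ _⇒_ (ren-id′ φ) (ren-id′ ψ)
  ren-id′ (∀̇ φ)    = cong ∀̇ (trans (ren-cong (λ { zero → refl ; (suc i) → refl }) φ) (ren-id′ φ))
  ren-id′ (∃̇ φ)    = cong ∃̇ (trans (ren-cong (λ { zero → refl ; (suc i) → refl }) φ) (ren-id′ φ))

ren-emb-closed : (ρ : Fin n → Fin m) (α : SFm 0) → ren ρ (ren emb α) ≡ ren emb α
ren-emb-closed ρ α = trans (ren-∘ ρ emb α) (ren-cong (λ ()) α)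

wk-ren-comm : (ρ : Fin n → Fin m) → ∀ φ → ren (ext ρ) (wk φ) ≡ wk (ren ρ φ)
wk-ren-comm ρ φ = trans (ren-∘ (ext ρ) suc φ) (sym (ren-∘ suc ρ φ))

map-wk-ren-comm : (ρ : Fin n → Fin m) → ∀ Γ → map (ren (ext ρ)) (map wk Γ) ≡ map wk (map (ren ρ) Γ)
map-wk-ren-comm ρ []      = refl
map-wk-ren-comm ρ (φ ∷ Γ) = cong₂ _∷_ (wk-ren-comm ρ φ) (map-wk-ren-comm ρ Γ)

inst-ren-comm : (ρ : Fin n → Fin m) (x : Fin n) → ∀ φ → ren ρ (φ [ x ]) ≡ (ren (ext ρ) φ) [ ρ x ]
inst-ren-comm ρ x φ =
  trans (ren-∘ ρ (inst x) φ)
        (trans (ren-cong (λ { zero → refl ; (suc i) → refl }) φ) (sym (ren-∘ (inst (ρ x)) (ext ρ) φ)))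

weaken : Γ ⊆ Δ → Γ ⊢ A → Δ ⊢ A
weaken s (hyp x)          = hyp (s x)
weaken s (⊥E d)           = ⊥E (weaken s d)
weaken s (∧I d e)         = ∧I (weaken s d) (weaken s e)
weaken s (∧E₁ d)          = ∧E₁ (weaken s d)
weaken s (∧E₂ d)          = ∧E₂ (weaken s d)
weaken s (∨I₁ d)          = ∨I₁ (weaken s d)
weaken s (∨I₂ d)          = ∨I₂ (weaken s d)
weaken s (∨E d e f)       = ∨E (weaken s d) (weaken (∷⁺ʳ _ s) e) (weaken (∷⁺ʳ _ s) f)
weaken s (⇒I d)           = ⇒I (weaken (∷⁺ʳ _ s) d)
weaken s (⇒E d e)         = ⇒E (weaken s d) (weaken s e)
weaken s (∀I d)           = ∀I (weaken (map⁺ wk s) d)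
weaken s (∀E d x)         = ∀E (weaken s d) x
weaken s (∃I x d)         = ∃I x (weaken s d)
weaken s (∃E d e)         = ∃E (weaken s d) (weaken (∷⁺ʳ _ (map⁺ wk s)) e)
weaken s (≐refl x)        = ≐refl x
weaken s (≐subst φ d e)   = ≐subst φ (weaken s d) (weaken s e)

ren-⊢ : (ρ : Fin n → Fin m) → Γ ⊢ A → map (ren ρ) Γ ⊢ ren ρ A
ren-⊢ ρ (hyp x)      = hyp (∈-map⁺ (ren ρ) x)
ren-⊢ ρ (⊥E d)       = ⊥E (ren-⊢ ρ d)
ren-⊢ ρ (∧I d e)     = ∧I (ren-⊢ ρ d) (ren-⊢ ρ e)
ren-⊢ ρ (∧E₁ d)      = ∧E₁ (ren-⊢ ρ d)
ren-⊢ ρ (∧E₂ d)      = ∧E₂ (ren-⊢ ρ d)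
ren-⊢ ρ (∨I₁ d)      = ∨I₁ (ren-⊢ ρ d)
ren-⊢ ρ (∨I₂ d)      = ∨I₂ (ren-⊢ ρ d)
ren-⊢ ρ (∨E d e f)   = ∨E (ren-⊢ ρ d) (ren-⊢ ρ e) (ren-⊢ ρ f)
ren-⊢ ρ (⇒I d)       = ⇒I (ren-⊢ ρ d)
ren-⊢ ρ (⇒E d e)     = ⇒E (ren-⊢ ρ d) (ren-⊢ ρ e)
ren-⊢ {Γ = Γ} ρ (∀I d)   = ∀I (subst (_⊢ _) (map-wk-ren-comm ρ Γ) (ren-⊢ (ext ρ) d))
ren-⊢ ρ (∀E {φ = φ} d x) = subst (_ ⊢_) (sym (inst-ren-comm ρ x φ)) (∀E (ren-⊢ ρ d) (ρ x))
ren-⊢ ρ (∃I {φ = φ} x d) = ∃I (ρ x) (subst (_ ⊢_) (inst-ren-comm ρ x φ) (ren-⊢ ρ d))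
ren-⊢ {Γ = Γ} ρ (∃E {φ = φ} {ψ} d e) =
  ∃E (ren-⊢ ρ d)
     (subst₂ _⊢_ (cong (ren (ext ρ) φ ∷_) (map-wk-ren-comm ρ Γ)) (wk-ren-comm ρ ψ) (ren-⊢ (ext ρ) e))
ren-⊢ ρ (≐refl x)    = ≐refl (ρ x)
ren-⊢ ρ (≐subst φ {x} {y} d e) =
  subst (_ ⊢_) (sym (inst-ren-comm ρ y φ))
    (≐subst (ren (ext ρ) φ) (ren-⊢ ρ d) (subst (_ ⊢_) (inst-ren-comm ρ x φ) (ren-⊢ ρ e)))

⊢-cast : A ≡ B → Γ ⊢ A → Γ ⊢ B
⊢-cast refl d = d

⊢wk : Γ ⊢ A → map wk Γ ⊢ wk A
⊢wk = ren-⊢ suc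

⊢∷ : Γ ⊢ A → B ∷ Γ ⊢ A
⊢∷ = weaken there

⊢∷∷ : Γ ⊢ A → C ∷ B ∷ Γ ⊢ A
⊢∷∷ = ⊢∷ ∘ ⊢∷

⊢wk∷ : Γ ⊢ A → B ∷ map wk Γ ⊢ wk A
⊢wk∷ = ⊢∷ ∘ ⊢wk

⊢wk∷∷ : Γ ⊢ A → C ∷ B ∷ map wk Γ ⊢ wk A
⊢wk∷∷ = ⊢∷∷ ∘ ⊢wk

hyp₀ : A ∷ Γ ⊢ A
hyp₀ = hyp (here refl)

hyp₁ : B ∷ A ∷ Γ ⊢ A
hyp₁ = hyp (there (here refl))

hyp₂ : C ∷ B ∷ A ∷ Γ ⊢ A
hyp₂ = hyp (there (there (here refl)))

⇔E₁ : Γ ⊢ A ⇔ B → Γ ⊢ A → Γ ⊢ B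
⇔E₁ d = ⇒E (∧E₁ d)

⇔E₂ : Γ ⊢ A ⇔ B → Γ ⊢ B → Γ ⊢ A
⇔E₂ d = ⇒E (∧E₂ d)

≐sym : {x y : Fin n} → Γ ⊢ x ≐ y → Γ ⊢ y ≐ x
≐sym {x = x} d = ≐subst (zero ≐ suc x) d (≐refl x)

≐trans : {x y z : Fin n} → Γ ⊢ x ≐ y → Γ ⊢ y ≐ z → Γ ⊢ x ≐ z
≐trans {x = x} d e = ≐subst (suc x ≐ zero) e d

∈-respˡ : {a b c : Fin n} → Γ ⊢ a ≐ b → Γ ⊢ a ∈ˢ c → Γ ⊢ b ∈ˢ c
∈-respˡ {c = c} = ≐subst (zero ∈ˢ suc c)

∈-respʳ : {a b c : Fin n} → Γ ⊢ a ≐ b → Γ ⊢ c ∈ˢ a → Γ ⊢ c ∈ˢ b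
∈-respʳ {c = c} = ≐subst (suc c ∈ˢ zero)

closeS-elim : (χ : SFm m) (ρ : Fin m → Fin n) → Γ ⊢ ren emb (closeS χ) → Γ ⊢ ren ρ χ
closeS-elim {zero}  χ ρ d = ⊢-cast (ren-cong (λ ()) χ) d
closeS-elim {suc m} χ ρ d = ⊢-cast inst-ext (∀E (closeS-elim (∀̇ χ) (ρ ∘′ suc) d) (ρ zero))
  where
  inst-ext : ren (inst (ρ zero)) (ren (ext (ρ ∘′ suc)) χ) ≡ ren ρ χ
  inst-ext = trans (ren-∘ _ _ χ) (ren-cong (λ { zero → refl ; (suc i) → refl }) χ)

data Step : Set where
  succ plus : Step

variable
  t : Step

StepRel : Step → Fin n → Fin n → Fin n → SFm n
StepRel succ x v w = IsSuc v w
StepRel plus x v w = AddF v x w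

baseValue : Step → Fin n → Fin n → Fin n
baseValue succ x e = x
baseValue plus x e = e

BaseClause : Step → Fin n → Fin n → SFm n
BaseClause t x f = ∀[ (λ e → Empty e ⇒ Holds (suc f) e (baseValue t (suc x) e)) ]

StepClause : Step → Fin n → Fin n → Fin n → SFm n
StepClause t x y f = ∀[ (λ k → k ∈ˢ suc y ⇒ ∀[ (λ k₁ → IsSuc (suc k) k₁ ⇒
  ∀[ (λ v → Holds (suc (suc (suc f))) (suc (suc k)) v ⇒
    ∀[ (λ v₁ → StepRel t (suc (suc (suc (suc x)))) (suc v) v₁ ⇒
      Holds (suc (suc (suc (suc f)))) (suc (suc k₁)) v₁) ]) ]) ]) ]

-- AddF x y z and MulF x y z unfold to RecFun succ x y z and RecFun plus x y z.
RecFun : Step → Fin n → Fin n → Fin n → SFm n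
RecFun t x y z = ∃[ (λ f → Functional f ∧ BaseClause t (suc x) f ∧ StepClause t (suc x) (suc y) f
                          ∧ Holds f (suc y) (suc z)) ]

DomainBound : Fin n → Fin n → SFm n
DomainBound f y = ∀[ (λ k → ∀[ (λ v → Holds (suc (suc f)) (suc k) v ⇒
  (suc k ∈ˢ suc (suc y) ∨ suc k ≐ suc (suc y))) ]) ]

IsRec : Step → Fin n → Fin n → Fin n → Fin n → SFm n
IsRec t x y f z = Functional f ∧ BaseClause t x f ∧ StepClause t x y f ∧ Holds f y z ∧ Nat z ∧ DomainBound f y

RecExists : Step → Fin n → Fin n → SFm n
RecExists t x y = ∃̇ (∃̇ (IsRec t (suc (suc x)) (suc (suc y)) (suc zero) zero))

SetInduction : SFm (suc n) → SFm n
SetInduction θ = ∀̇ (∀̇ (zero ∈ˢ suc zero ⇒ ren indRen θ) ⇒ θ) ⇒ ∀̇ θ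

irreflexivityF : SFm 1
irreflexivityF = ¬̇ (zero ∈ˢ zero)

recursionF : Step → SFm 2
recursionF t = Nat zero ⇒ RecExists t (suc zero) zero

-- parameters a = 1, b = 2 and two functions f = 3, g = 4; induction variable k = 0
agreementF : SFm 5
agreementF = (zero ∈ˢ suc (suc zero) ∨ zero ≐ suc (suc zero)) ⇒
  ∃̇ (Holds (suc (suc (suc (suc zero)))) (suc zero) zero ∧ Holds (suc (suc (suc (suc (suc zero))))) (suc zero) zero)

extensionalityF pairingF unionF intersectionF : SFm 0
extensionalityF = ∀[ (λ x → ∀[ (λ y →
  ∀[ (λ z → z ∈ˢ suc (suc x) ⇔ z ∈ˢ suc y) ] ⇒ suc x ≐ y) ]) ]
pairingF = ∀[ (λ x → ∀[ (λ y → ∃[ (λ p → ∀[ (λ z →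
  z ∈ˢ suc p ⇔ (z ≐ suc (suc (suc x)) ∨ z ≐ suc (suc y))) ]) ]) ]) ]
unionF = ∀[ (λ x → ∃[ (λ u → ∀[ (λ z →
  z ∈ˢ suc u ⇔ ∃[ (λ w → w ∈ˢ suc (suc (suc x)) ∧ suc z ∈ˢ w) ]) ]) ]) ]
intersectionF = ∀[ (λ x → ∀[ (λ y → ∃[ (λ i → ∀[ (λ z →
  z ∈ˢ suc i ⇔ (z ∈ˢ suc (suc (suc x)) ∧ z ∈ˢ suc (suc y))) ]) ]) ]) ]

axioms : List (SFm 0)
axioms = extensionalityF ∷ pairingF ∷ unionF ∷ intersectionF
       ∷ closeS (SetInduction irreflexivityF) ∷ closeS (SetInduction (recursionF succ))
       ∷ closeS (SetInduction (recursionF plus)) ∷ closeS (SetInduction agreementF) ∷ []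

Ax : List (SFm n) → Set
Ax Γ = ∀ {α} → α ∈ axioms → Γ ⊢ ren emb α

Ax-wk : Ax Γ → Ax (map wk Γ)
Ax-wk ax {α} α∈ = ⊢-cast (ren-emb-closed suc α) (⊢wk (ax α∈))

Ax-∷ : Ax Γ → Ax (B ∷ Γ)
Ax-∷ ax α∈ = ⊢∷ (ax α∈)

Ax-wk∷ : Ax Γ → Ax (B ∷ map wk Γ)
Ax-wk∷ ax = Ax-∷ (Ax-wk ax)

extensionality∈ : extensionalityF ∈ axioms
extensionality∈ = here refl

pairing∈ : pairingF ∈ axioms
pairing∈ = there (here refl)

union∈ : unionF ∈ axioms
union∈ = there (there (here refl))

intersection∈ : intersectionF ∈ axioms
intersection∈ = there (there (there (here refl)))

irreflexivity∈ : closeS (SetInduction irreflexivityF) ∈ axioms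
irreflexivity∈ = there (there (there (there (here refl))))

recursion∈ : ∀ t → closeS (SetInduction (recursionF t)) ∈ axioms
recursion∈ succ = there (there (there (there (there (here refl)))))
recursion∈ plus = there (there (there (there (there (there (here refl))))))

agreement∈ : closeS (SetInduction agreementF) ∈ axioms
agreement∈ = there (there (there (there (there (there (there (here refl)))))))

-- Rules in continuation style: the continuation receives the weakening (Wk) or the lifting (Lift)
-- into the extended context and, in the ᴬ variants, the axioms there.
Lift : List (SFm n) → List (SFm (suc n)) → Set
Lift Γ Δ = ∀ {A} → Γ ⊢ A → Δ ⊢ wk A

Wk : List (SFm n) → List (SFm n) → Set
Wk Γ Δ = ∀ {A} → Γ ⊢ A → Δ ⊢ A

∃E′ : Γ ⊢ ∃̇ A → (Lift Γ (A ∷ map wk Γ) → (A ∷ map wk Γ) ⊢ A → (A ∷ map wk Γ) ⊢ wk B) → Γ ⊢ B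
∃E′ d κ = ∃E d (κ ⊢wk∷ hyp₀)

∃Eᴬ : Ax Γ → Γ ⊢ ∃̇ A → (Ax (A ∷ map wk Γ) → Lift Γ (A ∷ map wk Γ) → (A ∷ map wk Γ) ⊢ A → (A ∷ map wk Γ) ⊢ wk B) → Γ ⊢ B
∃Eᴬ ax d κ = ∃E d (κ (Ax-wk∷ ax) ⊢wk∷ hyp₀)

∀I′ : {A : SFm (suc n)} → (Lift Γ (map wk Γ) → map wk Γ ⊢ A) → Γ ⊢ ∀̇ A
∀I′ κ = ∀I (κ ⊢wk)

∀Iᴬ : {A : SFm (suc n)} → Ax Γ → (Ax (map wk Γ) → Lift Γ (map wk Γ) → map wk Γ ⊢ A) → Γ ⊢ ∀̇ A
∀Iᴬ ax κ = ∀I (κ (Ax-wk ax) ⊢wk)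

⇒I′ : (Wk Γ (A ∷ Γ) → (A ∷ Γ) ⊢ A → (A ∷ Γ) ⊢ B) → Γ ⊢ A ⇒ B
⇒I′ κ = ⇒I (κ ⊢∷ hyp₀)

⇒Iᴬ : Ax Γ → (Ax (A ∷ Γ) → Wk Γ (A ∷ Γ) → (A ∷ Γ) ⊢ A → (A ∷ Γ) ⊢ B) → Γ ⊢ A ⇒ B
⇒Iᴬ ax κ = ⇒I (κ (Ax-∷ ax) ⊢∷ hyp₀)

∨E′ : Γ ⊢ A ∨ B → (Wk Γ (A ∷ Γ) → (A ∷ Γ) ⊢ A → (A ∷ Γ) ⊢ C) → (Wk Γ (B ∷ Γ) → (B ∷ Γ) ⊢ B → (B ∷ Γ) ⊢ C) → Γ ⊢ C
∨E′ d κ₁ κ₂ = ∨E d (κ₁ ⊢∷ hyp₀) (κ₂ ⊢∷ hyp₀)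

∨Eᴬ : Ax Γ → Γ ⊢ A ∨ B → (Ax (A ∷ Γ) → Wk Γ (A ∷ Γ) → (A ∷ Γ) ⊢ A → (A ∷ Γ) ⊢ C) →
     (Ax (B ∷ Γ) → Wk Γ (B ∷ Γ) → (B ∷ Γ) ⊢ B → (B ∷ Γ) ⊢ C) → Γ ⊢ C
∨Eᴬ ax d κ₁ κ₂ = ∨E d (κ₁ (Ax-∷ ax) ⊢∷ hyp₀) (κ₂ (Ax-∷ ax) ⊢∷ hyp₀)

≐-ext : Ax Γ → (a b : Fin n) → map wk Γ ⊢ (zero ∈ˢ suc a ⇔ zero ∈ˢ suc b) → Γ ⊢ a ≐ b
≐-ext ax a b d = ⇒E (∀E (∀E (ax extensionality∈) a) b) (∀I d)

∈-irrefl : Ax Γ → (a : Fin n) → Γ ⊢ a ∈ˢ a → Γ ⊢ ⊥̇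
∈-irrefl {Γ = Γ} ax a d = ⇒E (∀E (⇒E (closeS-elim (SetInduction irreflexivityF) emb (ax irreflexivity∈)) prem) a) d
  where
  prem : Γ ⊢ ∀̇ (∀̇ (zero ∈ˢ suc zero ⇒ ¬̇ (zero ∈ˢ zero)) ⇒ ¬̇ (zero ∈ˢ zero))
  prem = ∀I (⇒I (⇒I (⇒E (⇒E (∀E hyp₁ zero) hyp₀) hyp₀)))

Empty-∉ : ∀ {e z : Fin n} → Γ ⊢ Empty e → Γ ⊢ z ∈ˢ e → Γ ⊢ ⊥̇
Empty-∉ {z = z} d m = ⇒E (∀E d z) m

Trans-∈ : ∀ {x y z : Fin n} → Γ ⊢ Trans x → Γ ⊢ y ∈ˢ x → Γ ⊢ z ∈ˢ y → Γ ⊢ z ∈ˢ x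
Trans-∈ {y = y} {z} t d1 d2 = ⇒E (∀E (⇒E (∀E t y) d1) z) d2

Ord-∈-Trans : ∀ {x y : Fin n} → Γ ⊢ Ord x → Γ ⊢ y ∈ˢ x → Γ ⊢ Trans y
Ord-∈-Trans {y = y} o d = ⇒E (∀E (∧E₂ o) y) d

Nat-elem-cases : ∀ {x y : Fin n} → Γ ⊢ Nat x → Γ ⊢ (y ∈ˢ x ∨ y ≐ x) →
        Γ ⊢ Empty y ∨ ∃[ (λ g → Ord g ∧ IsSuc g (suc y)) ]
Nat-elem-cases {y = y} N d = ⇒E (∀E (∧E₂ N) y) d

IsSuc-∈⁻ : ∀ {a s z : Fin n} → Γ ⊢ IsSuc a s → Γ ⊢ z ∈ˢ s → Γ ⊢ z ∈ˢ a ∨ z ≐ a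
IsSuc-∈⁻ {z = z} d m = ⇔E₁ (∀E d z) m

IsSuc-∈⁺ : ∀ {a s z : Fin n} → Γ ⊢ IsSuc a s → Γ ⊢ z ∈ˢ a ∨ z ≐ a → Γ ⊢ z ∈ˢ s
IsSuc-∈⁺ {z = z} d m = ⇔E₂ (∀E d z) m

IsSuc-self : ∀ {a s : Fin n} → Γ ⊢ IsSuc a s → Γ ⊢ a ∈ˢ s
IsSuc-self {a = a} d = IsSuc-∈⁺ d (∨I₂ (≐refl a))

Nat-∈ : ∀ {x g : Fin n} → Γ ⊢ Nat x → Γ ⊢ g ∈ˢ x → Γ ⊢ Nat g
Nat-∈ N gx =
  ∧I (∧I (Ord-∈-Trans (∧E₁ N) gx)
         (∀I (⇒I (Ord-∈-Trans (⊢wk∷ (∧E₁ N)) (Trans-∈ (⊢wk∷ (∧E₁ (∧E₁ N))) (⊢wk∷ gx) hyp₀)))))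
     (∀I (⇒I (Nat-elem-cases (⊢wk∷ N) (∨I₁ (∨E hyp₀ (Trans-∈ (⊢wk∷∷ (∧E₁ (∧E₁ N))) (⊢wk∷∷ gx) hyp₀)
                                         (∈-respˡ (≐sym hyp₀) (⊢wk∷∷ gx)))))))

Nat-IsSuc : ∀ {x s : Fin n} → Γ ⊢ Nat x → Γ ⊢ IsSuc x s → Γ ⊢ Nat s
Nat-IsSuc {x = x} N S =
  ∧I (∧I trS (∀I (⇒I (∨E (IsSuc-∈⁻ (⊢wk∷ S) hyp₀)
                         (Ord-∈-Trans (⊢wk∷∷ (∧E₁ N)) hyp₀)
                         (≐subst (Trans zero) (≐sym hyp₀) (⊢∷∷ (⊢wk (∧E₁ (∧E₁ N)))))))))
     (∀I (⇒I (∨E hyp₀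
        (Nat-elem-cases (⊢wk∷∷ N) (IsSuc-∈⁻ (⊢wk∷∷ S) hyp₀))
        (∨I₂ (∃I (suc x) (∧I (⊢∷∷ (⊢wk (∧E₁ N))) (≐subst (IsSuc (suc (suc x)) zero) (≐sym hyp₀) (⊢wk∷∷ S))))))))
  where
  trS = ∀I (⇒I (∀I (⇒I (IsSuc-∈⁺ (⊢∷ (⊢wk (⊢wk∷ S))) (∨I₁
          (∨E (IsSuc-∈⁻ (⊢∷ (⊢wk (⊢wk∷ S))) (⊢∷ (⊢wk hyp₀)))
              (Trans-∈ (⊢∷∷ (⊢wk (⊢wk∷ (∧E₁ (∧E₁ N))))) hyp₀ hyp₁)
              (∈-respʳ hyp₀ hyp₁)))))))

Nat-Empty : ∀ {e : Fin n} → Γ ⊢ Empty e → Γ ⊢ Nat e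
Nat-Empty E =
  ∧I (∧I (∀I (⇒I (⊥E (Empty-∉ (⊢wk∷ E) hyp₀)))) (∀I (⇒I (⊥E (Empty-∉ (⊢wk∷ E) hyp₀)))))
     (∀I (⇒I (∨E hyp₀ (⊥E (Empty-∉ (⊢wk∷∷ E) hyp₀)) (∨I₁ (≐subst (Empty zero) (≐sym hyp₀) (⊢wk∷∷ E))))))

Nat-cases : ∀ {x : Fin n} → Γ ⊢ Nat x →
  Γ ⊢ Empty x ∨ ∃[ (λ g → Nat g ∧ g ∈ˢ suc x ∧ IsSuc g (suc x)) ]
Nat-cases {x = x} N = ∨E (Nat-elem-cases N (∨I₂ (≐refl x))) (∨I₁ hyp₀)
  (∨I₂ (∃E hyp₀ (∃I zero (∧I (Nat-∈ (⊢∷ (⊢wk (⊢∷ N))) (IsSuc-self (∧E₂ hyp₀))) (∧I (IsSuc-self (∧E₂ hyp₀)) (∧E₂ hyp₀))))))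

IsSuc-unique : Ax Γ → ∀ {a b c : Fin n} → Γ ⊢ IsSuc a b → Γ ⊢ IsSuc a c → Γ ⊢ b ≐ c
IsSuc-unique ax {b = b} {c} d1 d2 =
  ≐-ext ax b c (∧I (⇒I (IsSuc-∈⁺ (⊢wk∷ d2) (IsSuc-∈⁻ (⊢wk∷ d1) hyp₀))) (⇒I (IsSuc-∈⁺ (⊢wk∷ d1) (IsSuc-∈⁻ (⊢wk∷ d2) hyp₀))))

IsSuc-injective : Ax Γ → ∀ {a b c : Fin n} → Γ ⊢ Trans a → Γ ⊢ IsSuc a c → Γ ⊢ IsSuc b c → Γ ⊢ a ≐ b
IsSuc-injective ax {a} T S1 S2 =
  ∨E (IsSuc-∈⁻ S2 (IsSuc-self S1))
     (∨E (IsSuc-∈⁻ (⊢∷ S1) (IsSuc-self (⊢∷ S2)))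
         (⊥E (∈-irrefl (Ax-∷ (Ax-∷ ax)) a (Trans-∈ (⊢∷∷ T) hyp₀ hyp₁)))
         (≐sym hyp₀))
     hyp₀

Empty-unique : Ax Γ → ∀ {a b : Fin n} → Γ ⊢ Empty a → Γ ⊢ Empty b → Γ ⊢ a ≐ b
Empty-unique ax {a} {b} Ea Eb = ≐-ext ax a b (∧I (⇒I (⊥E (Empty-∉ (⊢wk∷ Ea) hyp₀))) (⇒I (⊥E (Empty-∉ (⊢wk∷ Eb) hyp₀))))

Doub-exists : Ax Γ → (a b : Fin n) → Γ ⊢ ∃[ (λ w → Doub w (suc a) (suc b)) ]
Doub-exists ax a b = ∀E (∀E (ax pairing∈) a) b

Doub-∈⁻ : ∀ {w a b v : Fin n} → Γ ⊢ Doub w a b → Γ ⊢ v ∈ˢ w → Γ ⊢ v ≐ a ∨ v ≐ b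
Doub-∈⁻ {v = v} d m = ⇔E₁ (∀E d v) m

Doub-∈⁺ : ∀ {w a b v : Fin n} → Γ ⊢ Doub w a b → Γ ⊢ v ≐ a ∨ v ≐ b → Γ ⊢ v ∈ˢ w
Doub-∈⁺ {v = v} d m = ⇔E₂ (∀E d v) m

Sing-∈⁻ : ∀ {w a v : Fin n} → Γ ⊢ Sing w a → Γ ⊢ v ∈ˢ w → Γ ⊢ v ≐ a
Sing-∈⁻ {v = v} d m = ⇔E₁ (∀E d v) m

Sing-∈⁺ : ∀ {w a v : Fin n} → Γ ⊢ Sing w a → Γ ⊢ v ≐ a → Γ ⊢ v ∈ˢ w
Sing-∈⁺ {v = v} d m = ⇔E₂ (∀E d v) m

Sing-self : ∀ {w a : Fin n} → Γ ⊢ Sing w a → Γ ⊢ a ∈ˢ w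
Sing-self {a = a} d = Sing-∈⁺ d (≐refl a)

Doub-diag-Sing : ∀ {w a : Fin n} → Γ ⊢ Doub w a a → Γ ⊢ Sing w a
Doub-diag-Sing d = ∀I (∧I (⇒I (∨E (Doub-∈⁻ (⊢wk∷ d) hyp₀) hyp₀ hyp₀)) (⇒I (Doub-∈⁺ (⊢wk∷ d) (∨I₁ hyp₀))))

Sing-exists : Ax Γ → (a : Fin n) → Γ ⊢ ∃[ (λ w → Sing w (suc a)) ]
Sing-exists ax a = ∃E (Doub-exists ax a a) (∃I zero (Doub-diag-Sing hyp₀))

Union : Fin n → Fin n → SFm n
Union u a = ∀[ (λ z → z ∈ˢ suc u ⇔ ∃[ (λ w → w ∈ˢ suc (suc a) ∧ suc z ∈ˢ w) ]) ]

Union-exists : Ax Γ → (a : Fin n) → Γ ⊢ ∃[ (λ u → Union u (suc a)) ]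
Union-exists ax a = ∀E (ax union∈) a

Union₂ : Fin n → Fin n → Fin n → SFm n
Union₂ u a b = ∀[ (λ z → z ∈ˢ suc u ⇔ (z ∈ˢ suc a ∨ z ∈ˢ suc b)) ]

Union₂-∈⁻ : ∀ {u a b z : Fin n} → Γ ⊢ Union₂ u a b → Γ ⊢ z ∈ˢ u → Γ ⊢ z ∈ˢ a ∨ z ∈ˢ b
Union₂-∈⁻ {z = z} d m = ⇔E₁ (∀E d z) m

Union₂-∈⁺ : ∀ {u a b z : Fin n} → Γ ⊢ Union₂ u a b → Γ ⊢ z ∈ˢ a ∨ z ∈ˢ b → Γ ⊢ z ∈ˢ u
Union₂-∈⁺ {z = z} d m = ⇔E₂ (∀E d z) m

Doub-Union-Union₂ : ∀ {d a b u : Fin n} → Γ ⊢ Doub d a b → Γ ⊢ Union u d → Γ ⊢ Union₂ u a b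
Doub-Union-Union₂ {a = a} {b} D U = ∀I (∧I (⇒I fwd) (⇒I bwd))
  where
  fwd = ∃E (⇔E₁ (∀E (⊢wk∷ U) zero) hyp₀)
          (∨E (Doub-∈⁻ (⊢wk∷ (⊢∷ (⊢wk D))) (∧E₁ hyp₀)) (∨I₁ (∈-respʳ hyp₀ (∧E₂ hyp₁))) (∨I₂ (∈-respʳ hyp₀ (∧E₂ hyp₁))))
  bwd = ∨E hyp₀ (⇔E₂ (∀E (⊢∷∷ (⊢wk U)) zero) (∃I (suc a) (∧I (Doub-∈⁺ (⊢∷∷ (⊢wk D)) (∨I₁ (≐refl (suc a)))) hyp₀)))
              (⇔E₂ (∀E (⊢∷∷ (⊢wk U)) zero) (∃I (suc b) (∧I (Doub-∈⁺ (⊢∷∷ (⊢wk D)) (∨I₂ (≐refl (suc b)))) hyp₀)))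

Union₂-exists : Ax Γ → (a b : Fin n) → Γ ⊢ ∃[ (λ u → Union₂ u (suc a) (suc b)) ]
Union₂-exists ax a b = ∃E (Doub-exists ax a b) (∃E (Union-exists (Ax-wk∷ ax) zero) (∃I zero (Doub-Union-Union₂ hyp₁ hyp₀)))

Sing-Union₂-IsSuc : ∀ {t a u : Fin n} → Γ ⊢ Sing t a → Γ ⊢ Union₂ u a t → Γ ⊢ IsSuc a u
Sing-Union₂-IsSuc S U = ∀I (∧I (⇒I (∨E (Union₂-∈⁻ (⊢wk∷ U) hyp₀) (∨I₁ hyp₀) (∨I₂ (Sing-∈⁻ (⊢wk∷∷ S) hyp₀))))
                    (⇒I (Union₂-∈⁺ (⊢wk∷ U) (∨E hyp₀ (∨I₁ hyp₀) (∨I₂ (Sing-∈⁺ (⊢wk∷∷ S) hyp₀))))))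

IsSuc-exists : Ax Γ → (a : Fin n) → Γ ⊢ ∃[ (λ s → IsSuc (suc a) s) ]
IsSuc-exists ax a = ∃E (Sing-exists ax a) (∃E (Union₂-exists (Ax-wk∷ ax) (suc a) zero) (∃I zero (Sing-Union₂-IsSuc hyp₁ hyp₀)))

-- ∅ is a ∩ {a}, since a ∉ a.
Empty-exists : ∀ {n} {Γ : List (SFm n)} → Ax Γ → (a : Fin n) → Γ ⊢ ∃[ (λ e → Empty e) ]
Empty-exists ax a = ∃E (Sing-exists ax a) (∃E (∀E (∀E (Ax-wk∷ ax intersection∈) (suc a)) zero)
  (∃I zero (∀I (⇒I (∈-irrefl (Ax-∷ (Ax-wk (Ax-wk∷ (Ax-wk∷ ax)))) _
     (∈-respˡ (Sing-∈⁻ (⊢wk∷ (⊢wk∷ hyp₀)) (∧E₂ (⇔E₁ (∀E (⊢wk∷ hyp₀) zero) hyp₀))) (∧E₁ (⇔E₁ (∀E (⊢wk∷ hyp₀) zero) hyp₀))))))))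

Sing-unique : Ax Γ → ∀ {w s a : Fin n} → Γ ⊢ Sing w a → Γ ⊢ Sing s a → Γ ⊢ w ≐ s
Sing-unique ax {w} {s} S1 S2 = ≐-ext ax w s (∧I (⇒I (Sing-∈⁺ (⊢wk∷ S2) (Sing-∈⁻ (⊢wk∷ S1) hyp₀))) (⇒I (Sing-∈⁺ (⊢wk∷ S1) (Sing-∈⁻ (⊢wk∷ S2) hyp₀))))

Doub-unique : Ax Γ → ∀ {w s a b : Fin n} → Γ ⊢ Doub w a b → Γ ⊢ Doub s a b → Γ ⊢ w ≐ s
Doub-unique ax {w} {s} S1 S2 = ≐-ext ax w s (∧I (⇒I (Doub-∈⁺ (⊢wk∷ S2) (Doub-∈⁻ (⊢wk∷ S1) hyp₀))) (⇒I (Doub-∈⁺ (⊢wk∷ S1) (Doub-∈⁻ (⊢wk∷ S2) hyp₀))))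

OPair-∈⁻ : ∀ {p a b w : Fin n} → Γ ⊢ OPair p a b → Γ ⊢ w ∈ˢ p → Γ ⊢ Sing w a ∨ Doub w a b
OPair-∈⁻ {w = w} d m = ⇔E₁ (∀E d w) m

OPair-∈⁺ : ∀ {p a b w : Fin n} → Γ ⊢ OPair p a b → Γ ⊢ Sing w a ∨ Doub w a b → Γ ⊢ w ∈ˢ p
OPair-∈⁺ {w = w} d m = ⇔E₂ (∀E d w) m

OPair-intro : Ax Γ → ∀ {s d p a b : Fin n} → Γ ⊢ Sing s a → Γ ⊢ Doub d a b → Γ ⊢ Doub p s d → Γ ⊢ OPair p a b
OPair-intro ax {a = a} {b} S D P = ∀I (∧I
  (⇒I (∨E (Doub-∈⁻ (⊢wk∷ P) hyp₀)
          (∨I₁ (≐subst (Sing zero (suc (suc a))) (≐sym hyp₀) (⊢wk∷∷ S)))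
          (∨I₂ (≐subst (Doub zero (suc (suc a)) (suc (suc b))) (≐sym hyp₀) (⊢wk∷∷ D)))))
  (⇒I (∨E hyp₀ (Doub-∈⁺ (⊢wk∷∷ P) (∨I₁ (Sing-unique (Ax-∷ (Ax-∷ (Ax-wk ax))) hyp₀ (⊢wk∷∷ S))))
             (Doub-∈⁺ (⊢wk∷∷ P) (∨I₂ (Doub-unique (Ax-∷ (Ax-∷ (Ax-wk ax))) hyp₀ (⊢wk∷∷ D)))))))

OPair-exists : Ax Γ → (a b : Fin n) → Γ ⊢ ∃[ (λ p → OPair p (suc a) (suc b)) ]
OPair-exists ax a b = ∃E (Sing-exists ax a) (∃E (Doub-exists (Ax-wk∷ ax) (suc a) (suc b))
   (∃E (Doub-exists (Ax-wk∷ (Ax-wk∷ ax)) (suc zero) zero)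
     (∃I zero (OPair-intro (Ax-wk∷ (Ax-wk∷ (Ax-wk∷ ax))) (⊢wk∷ (⊢wk∷ hyp₀)) (⊢wk∷ hyp₀) hyp₀))))

OPair-injective₁ : Ax Γ → ∀ {p a b c d : Fin n} → Γ ⊢ OPair p a b → Γ ⊢ OPair p c d → Γ ⊢ a ≐ c
OPair-injective₁ ax {a = a} P1 P2 = ∃E (Sing-exists ax a)
  (∨E (OPair-∈⁻ (⊢wk∷ P2) (OPair-∈⁺ (⊢wk∷ P1) (∨I₁ hyp₀)))
      (≐sym (Sing-∈⁻ (⊢∷ hyp₀) (Sing-self hyp₀)))
      (≐sym (Sing-∈⁻ (⊢∷ hyp₀) (Doub-∈⁺ hyp₀ (∨I₁ (≐refl _))))))

OPair-injective₂ : Ax Γ → ∀ {p a b c d : Fin n} → Γ ⊢ OPair p a b → Γ ⊢ OPair p c d → Γ ⊢ b ≐ d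
OPair-injective₂ {Γ = Γ} ax {a = a} {b} {c} P1 P2 = ∃E (Doub-exists ax a b)
  (∨E (OPair-∈⁻ (⊢wk∷ P2) (OPair-∈⁺ (⊢wk∷ P1) (∨I₂ hyp₀)))
      (diagonal (Ax-∷ (Ax-wk∷ ax)) (⊢wk∷∷ P1) (⊢wk∷∷ P2) (≐trans (Sing-∈⁻ hyp₀ (Doub-∈⁺ (⊢∷ hyp₀) (∨I₂ (≐refl _)))) (≐sym (⊢wk∷∷ ac))))
      (∨E (Doub-∈⁻ hyp₀ (Doub-∈⁺ (⊢∷ hyp₀) (∨I₂ (≐refl _))))
          (diagonal (Ax-∷ (Ax-∷ (Ax-wk∷ ax))) (⊢∷ (⊢wk∷∷ P1)) (⊢∷ (⊢wk∷∷ P2)) (≐trans hyp₀ (≐sym (⊢∷ (⊢wk∷∷ ac)))))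
          hyp₀))
  where
  ac : Γ ⊢ a ≐ c
  ac = OPair-injective₁ ax P1 P2
  diagonal : ∀ {m} {Δ : List (SFm m)} {p a b c d : Fin m} → Ax Δ → Δ ⊢ OPair p a b → Δ ⊢ OPair p c d → Δ ⊢ b ≐ a → Δ ⊢ b ≐ d
  diagonal {c = c} {d} ax Q1 Q2 BA = ∃E (Doub-exists ax c d)
    (∨E (OPair-∈⁻ (⊢wk∷ Q1) (OPair-∈⁺ (⊢wk∷ Q2) (∨I₂ hyp₀)))
        (≐trans (⊢∷ (⊢wk∷ BA)) (≐sym (Sing-∈⁻ hyp₀ (Doub-∈⁺ (⊢∷ hyp₀) (∨I₂ (≐refl _))))))
        (∨E (Doub-∈⁻ hyp₀ (Doub-∈⁺ (⊢∷ hyp₀) (∨I₂ (≐refl _))))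
            (≐trans (⊢∷∷ (⊢wk∷ BA)) (≐sym hyp₀))
            (≐sym hyp₀)))

Functional-elim : ∀ {f k v w : Fin n} → Γ ⊢ Functional f → Γ ⊢ Holds f k v → Γ ⊢ Holds f k w → Γ ⊢ v ≐ w
Functional-elim {k = k} {v} {w} F hv hw = ⇒E (⇒E (∀E (∀E (∀E F k) v) w) hv) hw

Holds-respˡ : ∀ {f k k' v : Fin n} → Γ ⊢ k ≐ k' → Γ ⊢ Holds f k v → Γ ⊢ Holds f k' v
Holds-respˡ {f = f} {v = v} e h = ≐subst (Holds (suc f) zero (suc v)) e h

Holds-respʳ : ∀ {f k v v' : Fin n} → Γ ⊢ v ≐ v' → Γ ⊢ Holds f k v → Γ ⊢ Holds f k v'
Holds-respʳ {f = f} {k = k} e h = ≐subst (Holds (suc f) (suc k) zero) e h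

Holds-Empty : ∀ {f k v : Fin n} → Γ ⊢ Empty f → Γ ⊢ Holds f k v → Γ ⊢ ⊥̇
Holds-Empty E h = ∃E h (Empty-∉ (⊢wk∷ E) (∧E₂ hyp₀))

Extends : Fin n → Fin n → Fin n → Fin n → SFm n
Extends f' f y z = ∀[ (λ k → ∀[ (λ v → Holds (suc (suc f')) (suc k) v ⇔
   (Holds (suc (suc f)) (suc k) v ∨ (suc k ≐ suc (suc y) ∧ v ≐ suc (suc z)))) ]) ]

Extends-⁻ : ∀ {f' f y z k v : Fin n} → Γ ⊢ Extends f' f y z → Γ ⊢ Holds f' k v → Γ ⊢ Holds f k v ∨ (k ≐ y ∧ v ≐ z)
Extends-⁻ {k = k} {v} E h = ⇔E₁ (∀E (∀E E k) v) h

Extends-⁺ : ∀ {f' f y z k v : Fin n} → Γ ⊢ Extends f' f y z → Γ ⊢ Holds f k v ∨ (k ≐ y ∧ v ≐ z) → Γ ⊢ Holds f' k v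
Extends-⁺ {k = k} {v} E h = ⇔E₂ (∀E (∀E E k) v) h

Extends-intro : Ax Γ → ∀ {f y z q s f' : Fin n} → Γ ⊢ OPair q y z → Γ ⊢ Sing s q → Γ ⊢ Union₂ f' f s → Γ ⊢ Extends f' f y z
Extends-intro {Γ = Γ} ax {f} {y} {z} {q} {s} {f'} Q S U = ∀I (∀I (∧I (⇒I fwd) (⇒I bwd)))
  where
  fwd : (Holds (suc (suc f')) (suc zero) zero ∷ map wk (map wk Γ)) ⊢
        (Holds (suc (suc f)) (suc zero) zero ∨ (suc zero ≐ suc (suc y) ∧ zero ≐ suc (suc z)))
  fwd = ∃E hyp₀ (∨E (Union₂-∈⁻ (⊢wk∷ (⊢∷ (⊢wk (⊢wk U)))) (∧E₂ hyp₀))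
                 (∨I₁ (∃I zero (∧I (∧E₁ hyp₁) hyp₀)))
                 (∨I₂ (∧I (OPair-injective₁ ax4 (≐subst (OPair zero (suc (suc (suc zero))) (suc (suc zero))) (Sing-∈⁻ S4 hyp₀) (∧E₁ hyp₁)) Q4)
                          (OPair-injective₂ ax4 (≐subst (OPair zero (suc (suc (suc zero))) (suc (suc zero))) (Sing-∈⁻ S4 hyp₀) (∧E₁ hyp₁)) Q4))))
    where
    ax4 = Ax-∷ (Ax-∷ (Ax-wk (Ax-∷ (Ax-wk (Ax-wk ax)))))
    S4 = ⊢∷∷ (⊢wk (⊢∷ (⊢wk (⊢wk S))))
    Q4 = ⊢∷∷ (⊢wk (⊢∷ (⊢wk (⊢wk Q))))
  bwd : ((Holds (suc (suc f)) (suc zero) zero ∨ (suc zero ≐ suc (suc y) ∧ zero ≐ suc (suc z))) ∷ map wk (map wk Γ)) ⊢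
        Holds (suc (suc f')) (suc zero) zero
  bwd = ∨E hyp₀ (∃E hyp₀ (∃I zero (∧I (∧E₁ hyp₀) (Union₂-∈⁺ (⊢wk∷ (⊢∷∷ (⊢wk (⊢wk U)))) (∨I₁ (∧E₂ hyp₀))))))
               (Holds-respʳ (≐sym (∧E₂ hyp₀)) (Holds-respˡ (≐sym (∧E₁ hyp₀))
                 (∃I _ (∧I (⊢∷∷ (⊢wk (⊢wk Q))) (Union₂-∈⁺ (⊢∷∷ (⊢wk (⊢wk U))) (∨I₂ (Sing-self (⊢∷∷ (⊢wk (⊢wk S))))))))))

Extends-exists : Ax Γ → (f y z : Fin n) → Γ ⊢ ∃[ (λ f' → Extends f' (suc f) (suc y) (suc z)) ]
Extends-exists ax f y z = ∃E (OPair-exists ax y z) (∃E (Sing-exists (Ax-wk∷ ax) zero) (∃E (Union₂-exists (Ax-wk∷ (Ax-wk∷ ax)) (suc (suc f)) zero)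
  (∃I zero (Extends-intro (Ax-wk∷ (Ax-wk∷ (Ax-wk∷ ax))) (⊢wk∷ (⊢wk∷ hyp₀)) (⊢wk∷ hyp₀) hyp₀))))

Undefined : Fin n → Fin n → SFm n
Undefined f y = ∀[ (λ k → ∀[ (λ v → Holds (suc (suc f)) (suc k) v ⇒ suc k ≐ suc (suc y) ⇒ ⊥̇) ]) ]

Undefined-elim : ∀ {f y k v : Fin n} → Γ ⊢ Undefined f y → Γ ⊢ Holds f k v → Γ ⊢ k ≐ y → Γ ⊢ ⊥̇
Undefined-elim {k = k} {v} N h e = ⇒E (⇒E (∀E (∀E N k) v) h) e

DomainBound-elim : ∀ {f y k v : Fin n} → Γ ⊢ DomainBound f y → Γ ⊢ Holds f k v → Γ ⊢ k ∈ˢ y ∨ k ≐ y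
DomainBound-elim {k = k} {v} D h = ⇒E (∀E (∀E D k) v) h

Extends-Functional : ∀ {f y z f' : Fin n} → Γ ⊢ Functional f → Γ ⊢ Undefined f y → Γ ⊢ Extends f' f y z → Γ ⊢ Functional f'
Extends-Functional F N E = ∀I (∀I (∀I (⇒I (⇒I
  (∨E (Extends-⁻ (L E) hyp₁)
      (∨E (Extends-⁻ (⊢∷ (L E)) hyp₁)
          (Functional-elim (⊢∷∷ (L F)) hyp₁ hyp₀)
          (⊥E (Undefined-elim (⊢∷∷ (L N)) hyp₁ (∧E₁ hyp₀))))
      (∨E (Extends-⁻ (⊢∷ (L E)) hyp₁)
          (⊥E (Undefined-elim (⊢∷∷ (L N)) hyp₀ (∧E₁ hyp₁)))
          (≐trans (∧E₂ hyp₁) (≐sym (∧E₂ hyp₀)))))))))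
  where
  L : ∀ {A B C} → Γ ⊢ A → (C ∷ B ∷ map wk (map wk (map wk Γ))) ⊢ wk (wk (wk A))
  L X = ⊢∷∷ (⊢wk (⊢wk (⊢wk X)))

Embedding : (Fin n → Fin m) → List (SFm n) → List (SFm m) → Set
Embedding ρ Γ Δ = Ax Δ × (∀ {A} → Γ ⊢ A → Δ ⊢ ren ρ A)

Embedding-refl : Ax Γ → Embedding id Γ Γ
Embedding-refl ax = ax , λ {A} d → ⊢-cast (sym (ren-id (λ _ → refl) A)) d

Embedding-wk : {ρ : Fin n → Fin m} → Embedding ρ Γ Δ → Embedding (suc ∘′ ρ) Γ (map wk Δ)
Embedding-wk {ρ = ρ} (ax , tr) = Ax-wk ax , λ {A} d → ⊢-cast (ren-∘ suc ρ A) (⊢wk (tr d))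

Embedding-unwk : {ρ : Fin (suc n) → Fin m} → Embedding ρ (map wk Γ) Δ → Embedding (ρ ∘′ suc) Γ Δ
Embedding-unwk {ρ = ρ} (ax , tr) = ax , λ {A} d → ⊢-cast (ren-∘ ρ suc A) (tr (⊢wk d))

IsRec-functional : ∀ {x y f z : Fin n} → Γ ⊢ IsRec t x y f z → Γ ⊢ Functional f
IsRec-functional R = ∧E₁ R

IsRec-base : ∀ {x y f z : Fin n} → Γ ⊢ IsRec t x y f z → Γ ⊢ BaseClause t x f
IsRec-base R = ∧E₁ (∧E₂ R)

IsRec-step : ∀ {x y f z : Fin n} → Γ ⊢ IsRec t x y f z → Γ ⊢ StepClause t x y f
IsRec-step R = ∧E₁ (∧E₂ (∧E₂ R))

IsRec-value : ∀ {x y f z : Fin n} → Γ ⊢ IsRec t x y f z → Γ ⊢ Holds f y z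
IsRec-value R = ∧E₁ (∧E₂ (∧E₂ (∧E₂ R)))

IsRec-Nat : ∀ {x y f z : Fin n} → Γ ⊢ IsRec t x y f z → Γ ⊢ Nat z
IsRec-Nat R = ∧E₁ (∧E₂ (∧E₂ (∧E₂ (∧E₂ R))))

IsRec-domain : ∀ {x y f z : Fin n} → Γ ⊢ IsRec t x y f z → Γ ⊢ DomainBound f y
IsRec-domain R = ∧E₂ (∧E₂ (∧E₂ (∧E₂ (∧E₂ R))))

RecSucc : Step → Fin n → Fin n → Fin n → SFm n
RecSucc t x y s = ∃̇ (∃̇ (Nat (suc zero) ∧ Nat zero
  ∧ RecFun t (suc (suc x)) (suc (suc y)) (suc zero) ∧ RecFun t (suc (suc x)) (suc (suc s)) zero
  ∧ StepRel t (suc (suc x)) (suc zero) zero))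

module Addition where

  StepRel-total : Ax Γ → ∀ {x v : Fin n} → Γ ⊢ Nat x → Γ ⊢ Nat v → Γ ⊢ ∃[ (λ w → Nat w ∧ StepRel succ (suc x) (suc v) w) ]
  StepRel-total ax {v = v} _ Nv = ∃E (IsSuc-exists ax v) (∃I zero (∧I (Nat-IsSuc (⊢wk∷ Nv) hyp₀) hyp₀))

  StepRel-unique : Ax Γ → ∀ {x v w w' : Fin n} → Γ ⊢ Nat x → Γ ⊢ StepRel succ x v w → Γ ⊢ StepRel succ x v w' → Γ ⊢ w ≐ w'
  StepRel-unique ax _ = IsSuc-unique ax

  baseValue-resp : ∀ {x e y : Fin n} → Γ ⊢ e ≐ y → Γ ⊢ baseValue succ x e ≐ baseValue succ x y
  baseValue-resp {x = x} _ = ≐refl x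

  Nat-baseValue : ∀ {x y : Fin n} → Γ ⊢ Nat x → Γ ⊢ Empty y → Γ ⊢ Nat (baseValue succ x y)
  Nat-baseValue Nx _ = Nx

  StepRel-resp : ∀ {x v v' w : Fin n} → Γ ⊢ v ≐ v' → Γ ⊢ StepRel succ x v w → Γ ⊢ StepRel succ x v' w
  StepRel-resp {x = x} {w = w} e d = ≐subst (StepRel succ (suc x) zero (suc w)) e d

  StepClause-elim : ∀ {x y f k k₁ v v₁ : Fin n} → Γ ⊢ StepClause succ x y f → Γ ⊢ k ∈ˢ y → Γ ⊢ IsSuc k k₁ →
            Γ ⊢ Holds f k v → Γ ⊢ StepRel succ x v v₁ → Γ ⊢ Holds f k₁ v₁
  StepClause-elim {k = k} {k₁} {v} {v₁} S a b c d = ⇒E (∀E (⇒E (∀E (⇒E (∀E (⇒E (∀E S k) a) k₁) b) v) c) v₁) d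

  BaseClause-elim : ∀ {x f e : Fin n} → Γ ⊢ BaseClause succ x f → Γ ⊢ Empty e → Γ ⊢ Holds f e (baseValue succ x e)
  BaseClause-elim {e = e} B E = ⇒E (∀E B e) E

  Extends-step : Ax Γ → ∀ {x y g f z z' f' k k₁ v v₁ : Fin n} → Γ ⊢ Nat x → Γ ⊢ IsSuc g y →
    Γ ⊢ Functional f → Γ ⊢ StepClause succ x g f → Γ ⊢ Holds f g z → Γ ⊢ StepRel succ x z z' → Γ ⊢ Extends f' f y z' →
    Γ ⊢ k ∈ˢ y → Γ ⊢ IsSuc k k₁ → Γ ⊢ Holds f' k v → Γ ⊢ StepRel succ x v v₁ → Γ ⊢ Holds f' k₁ v₁
  Extends-step ax {x} {y} {k₁ = k₁} Nx g⁺ F S H s E k∈y k⁺ hk sv =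
    ∨E (Extends-⁻ E hk)
       (∨E (IsSuc-∈⁻ (⊢∷ g⁺) (⊢∷ k∈y))
           (Extends-⁺ (⊢∷∷ E) (∨I₁ (StepClause-elim {x = x} (⊢∷∷ S) hyp₀ (⊢∷∷ k⁺) hyp₁ (⊢∷∷ sv))))
           (Extends-⁺ (⊢∷∷ E) (∨I₂ (∧I
             (≐sym (IsSuc-unique ax″ (⊢∷∷ g⁺) (≐subst (IsSuc zero (suc k₁)) hyp₀ (⊢∷∷ k⁺))))
             (StepRel-unique ax″ (⊢∷∷ Nx)
               (StepRel-resp {x = x} (Functional-elim (⊢∷∷ F) (Holds-respˡ hyp₀ hyp₁) (⊢∷∷ H)) (⊢∷∷ sv))
               (⊢∷∷ s))))))
       (⊥E (∈-irrefl (Ax-∷ ax) y (∈-respˡ (∧E₁ hyp₀) (⊢∷ k∈y))))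
    where
    ax″ = Ax-∷ (Ax-∷ ax)

  IsRec-extend : Ax Γ → ∀ {x y g f z z' f' : Fin n} → Γ ⊢ Nat x → Γ ⊢ Nat y → Γ ⊢ g ∈ˢ y →
    Γ ⊢ IsSuc g y → Γ ⊢ IsRec succ x g f z → Γ ⊢ Nat z' → Γ ⊢ StepRel succ x z z' → Γ ⊢ Extends f' f y z' →
    Γ ⊢ IsRec succ x y f' z'
  IsRec-extend {Γ = Γ} ax {x} {y} {g} {f} {z} {z'} {f'} Nx Ny g∈y g⁺ R Nz' Szz' E =
    ∧I (Extends-Functional (IsRec-functional R) undefined E)
    (∧I base (∧I step (∧I (Extends-⁺ E (∨I₂ (∧I (≐refl y) (≐refl z')))) (∧I Nz' domain))))
    where
    Ty : Γ ⊢ Trans y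
    Ty = ∧E₁ (∧E₁ Ny)
    Dom : Γ ⊢ DomainBound f g
    Dom = IsRec-domain R
    undefined : Γ ⊢ Undefined f y
    undefined = ∀Iᴬ ax λ ax₁ L₁ → ∀Iᴬ ax₁ λ ax₂ L₂ → ⇒Iᴬ ax₂ λ ax₃ W₃ hf′ → ⇒Iᴬ ax₃ λ ax₄ W₄ k≐y →
       let q1 = W₄ (W₃ (L₂ (L₁ Dom))) ; q2 = W₄ hf′ ; q3 = W₄ (W₃ (L₂ (L₁ Ty))) ; q4 = W₄ (W₃ (L₂ (L₁ g∈y))) in
       ∨Eᴬ ax₄ (DomainBound-elim q1 q2)
          (λ ax₅ W₅ kg → let r1 = W₅ q3 ; r2 = W₅ q4 ; r3 = W₅ k≐y in ∈-irrefl ax₅ (suc (suc y)) (Trans-∈ r1 r2 (∈-respˡ r3 kg)))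
          (λ ax₅ W₅ kg → let r2 = W₅ q4 ; r3 = W₅ k≐y in ∈-irrefl ax₅ (suc (suc y)) (∈-respˡ (≐trans (≐sym kg) r3) r2))
    base : Γ ⊢ BaseClause succ x f'
    base = ∀Iᴬ ax λ ax₁ L₁ → ⇒Iᴬ ax₁ λ ax₂ W₂ e → let q1 = W₂ (L₁ E) ; q2 = W₂ (L₁ (IsRec-base R)) in Extends-⁺ q1 (∨I₁ (BaseClause-elim {x = suc x} q2 e))
    domain : Γ ⊢ DomainBound f' y
    domain = ∀Iᴬ ax λ ax₁ L₁ → ∀Iᴬ ax₁ λ ax₂ L₂ → ⇒Iᴬ ax₂ λ ax₃ W₃ hf′ →
       let q1 = W₃ (L₂ (L₁ E)) ; q2 = W₃ (L₂ (L₁ Dom)) ; q3 = W₃ (L₂ (L₁ Ty)) ; q4 = W₃ (L₂ (L₁ g∈y)) in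
       ∨Eᴬ ax₃ (Extends-⁻ q1 hf′)
       (λ ax₄ W₄ hf → let r2 = W₄ q2 ; r3 = W₄ q3 ; r4 = W₄ q4 in ∨I₁ (∨Eᴬ ax₄ (DomainBound-elim r2 hf)
           (λ ax₅ W₅ kg → let u3 = W₅ r3 ; u4 = W₅ r4 in Trans-∈ u3 u4 kg)
           (λ ax₅ W₅ kg → let u4 = W₅ r4 in ∈-respˡ (≐sym kg) u4)))
       (λ ax₄ W₄ e → ∨I₂ (∧E₁ e))
    step : Γ ⊢ StepClause succ x y f'
    step = ∀Iᴬ ax λ ax₁ L₁ → ⇒Iᴬ ax₁ λ ax₂ W₂ k∈y → ∀Iᴬ ax₂ λ ax₃ L₃ → ⇒Iᴬ ax₃ λ ax₄ W₄ k⁺ → ∀Iᴬ ax₄ λ ax₅ L₅ → ⇒Iᴬ ax₅ λ ax₆ W₆ hk →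
            ∀Iᴬ ax₆ λ ax₇ L₇ → ⇒Iᴬ ax₇ λ ax₈ W₈ sv →
      let p1 = W₈ (L₇ (W₆ (L₅ (W₄ (L₃ (W₂ (L₁ (Nx))))))))
          p2 = W₈ (L₇ (W₆ (L₅ (W₄ (L₃ (W₂ (L₁ (g⁺))))))))
          p3 = W₈ (L₇ (W₆ (L₅ (W₄ (L₃ (W₂ (L₁ (IsRec-functional R))))))))
          p4 = W₈ (L₇ (W₆ (L₅ (W₄ (L₃ (W₂ (L₁ (IsRec-step R))))))))
          p5 = W₈ (L₇ (W₆ (L₅ (W₄ (L₃ (W₂ (L₁ (IsRec-value R))))))))
          p6 = W₈ (L₇ (W₆ (L₅ (W₄ (L₃ (W₂ (L₁ (Szz'))))))))
          p7 = W₈ (L₇ (W₆ (L₅ (W₄ (L₃ (W₂ (L₁ (E))))))))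
          p8 = W₈ (L₇ (W₆ (L₅ (W₄ (L₃ k∈y)))))
          p9 = W₈ (L₇ (W₆ (L₅ k⁺)))
          p10 = W₈ (L₇ hk)
      in Extends-step ax₈ {suc (suc (suc (suc x)))} {suc (suc (suc (suc y)))} {suc (suc (suc (suc g)))} {suc (suc (suc (suc f)))}
        {suc (suc (suc (suc z)))} {suc (suc (suc (suc z')))} {suc (suc (suc (suc f')))}
        {suc (suc (suc zero))} {suc (suc zero)} {suc zero} {zero}
        p1 p2 p3 p4 p5 p6 p7 p8 p9 p10 sv

  IsRec-empty : Ax Γ → ∀ {x y f' : Fin n} → Γ ⊢ Nat x → Γ ⊢ Empty y → Γ ⊢ Extends f' y y (baseValue succ x y) →
    Γ ⊢ IsRec succ x y f' (baseValue succ x y)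
  IsRec-empty {Γ = Γ} ax {x} {y} {f'} Nx Ey E =
    ∧I (Extends-Functional y-functional y-undefined E) (∧I base (∧I step (∧I (Extends-⁺ E (∨I₂ (∧I (≐refl y) (≐refl _)))) (∧I (Nat-baseValue Nx Ey) domain))))
    where
    y-functional : Γ ⊢ Functional y
    y-functional = ∀I′ λ L₁ → ∀I′ λ L₂ → ∀I′ λ L₃ → ⇒I′ λ W₄ hA → ⇒I′ λ W₅ hB → let q = W₅ (W₄ (L₃ (L₂ (L₁ Ey)))) ; q' = W₅ hA in ⊥E (Holds-Empty q q')
    y-undefined : Γ ⊢ Undefined y y
    y-undefined = ∀I′ λ L₁ → ∀I′ λ L₂ → ⇒I′ λ W₃ hA → ⇒I′ λ W₄ e → let q = W₄ (W₃ (L₂ (L₁ Ey))) ; q' = W₄ hA in ⊥E (Holds-Empty q q')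
    base : Γ ⊢ BaseClause succ x f'
    base = ∀Iᴬ ax λ ax₁ L₁ → ⇒Iᴬ ax₁ λ ax₂ W₂ ee →
      let q1 = W₂ (L₁ E) ; q2 = W₂ (L₁ Ey) in
      Extends-⁺ q1 (∨I₂ (∧I (Empty-unique ax₂ ee q2) (baseValue-resp {x = suc x} (Empty-unique ax₂ ee q2))))
    step : Γ ⊢ StepClause succ x y f'
    step = ∀I′ λ L₁ → ⇒I′ λ W₂ k∈y → let q = W₂ (L₁ Ey) in ⊥E (Empty-∉ q k∈y)
    domain : Γ ⊢ DomainBound f' y
    domain = ∀I′ λ L₁ → ∀I′ λ L₂ → ⇒I′ λ W₃ hA → let q1 = W₃ (L₂ (L₁ E)) ; q2 = W₃ (L₂ (L₁ Ey)) in ∨E′ (Extends-⁻ q1 hA)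
       (λ W₄ hf → let r = W₄ q2 in ⊥E (Holds-Empty r hf)) (λ W₄ e → ∨I₂ (∧E₁ e))

  RecExists-from-step : Ax Γ → ∀ {x y g f z z' : Fin n} → Γ ⊢ Nat x → Γ ⊢ Nat y → Γ ⊢ g ∈ˢ y → Γ ⊢ IsSuc g y →
    Γ ⊢ IsRec succ x g f z → Γ ⊢ Nat z' → Γ ⊢ StepRel succ x z z' → Γ ⊢ RecExists succ x y
  RecExists-from-step ax {x} {y} {g} {f} {z} {z'} Nx Ny g∈y g⁺ R Nz' Szz' =
    ∃Eᴬ {A = Extends zero (suc f) (suc y) (suc z')} {B = RecExists succ x y} ax (Extends-exists ax f y z') λ ax₁ L₁ e →
      let p1 = L₁ Nx ; p2 = L₁ Ny ; p3 = L₁ g∈y ; p4 = L₁ g⁺ ; p5 = L₁ R ; p6 = L₁ Nz' ; p7 = L₁ Szz'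
      in ∃I zero (∃I (suc z')
         (IsRec-extend ax₁ {suc x} {suc y} {suc g} {suc f} {suc z} {suc z'} {zero} p1 p2 p3 p4 p5 p6 p7 e))

  RecExists-from-IsRec : Ax Γ → ∀ {x y g f z : Fin n} → Γ ⊢ Nat x → Γ ⊢ Nat y → Γ ⊢ g ∈ˢ y → Γ ⊢ IsSuc g y →
    Γ ⊢ IsRec succ x g f z → Γ ⊢ RecExists succ x y
  RecExists-from-IsRec ax {x} {y} {g} {f} {z} Nx Ny g∈y g⁺ R =
    ∃Eᴬ {A = Nat zero ∧ StepRel succ (suc x) (suc z) zero} {B = RecExists succ x y} ax (StepRel-total ax {x} {z} Nx (IsRec-Nat R)) λ ax₁ L₁ h →
       let p1 = L₁ Nx ; p2 = L₁ Ny ; p3 = L₁ g∈y ; p4 = L₁ g⁺ ; p5 = L₁ R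
       in RecExists-from-step ax₁ {suc x} {suc y} {suc g} {suc f} {suc z} {zero} p1 p2 p3 p4 p5 (∧E₁ h) (∧E₂ h)

  RecExists-next : Ax Γ → ∀ {x y g : Fin n} → Γ ⊢ Nat x → Γ ⊢ Nat y → Γ ⊢ g ∈ˢ y → Γ ⊢ IsSuc g y →
    Γ ⊢ RecExists succ x g → Γ ⊢ RecExists succ x y
  RecExists-next ax {x} {y} {g} Nx Ny g∈y g⁺ RE =
    ∃Eᴬ {A = ∃̇ (IsRec succ (suc (suc x)) (suc (suc g)) (suc zero) zero)} {B = RecExists succ x y} ax RE λ ax₁ L₁ ∃R →
    ∃Eᴬ {A = IsRec succ (suc (suc x)) (suc (suc g)) (suc zero) zero} {B = RecExists succ (suc x) (suc y)} ax₁ ∃R λ ax₂ L₂ R →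
      let p1 = L₂ (L₁ Nx) ; p2 = L₂ (L₁ Ny) ; p3 = L₂ (L₁ g∈y) ; p4 = L₂ (L₁ g⁺)
      in RecExists-from-IsRec ax₂ {suc (suc x)} {suc (suc y)} {suc (suc g)} {suc zero} {zero} p1 p2 p3 p4 R

  RecExists-empty : Ax Γ → ∀ {x y : Fin n} → Γ ⊢ Nat x → Γ ⊢ Empty y → Γ ⊢ RecExists succ x y
  RecExists-empty ax {x} {y} Nx Ey =
    ∃Eᴬ {A = Extends zero (suc y) (suc y) (suc (baseValue succ x y))} {B = RecExists succ x y} ax (Extends-exists ax y y (baseValue succ x y)) λ ax₁ L₁ e →
      let p1 = L₁ Nx ; p2 = L₁ Ey in ∃I zero (∃I (baseValue succ (suc x) (suc y)) (IsRec-empty ax₁ p1 p2 e))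

  RecExists-succ : Ax Γ → ∀ {x y : Fin n} → Γ ⊢ Nat x → Γ ⊢ Nat y →
            Γ ⊢ ∀̇ (zero ∈ˢ suc y ⇒ Nat zero ⇒ RecExists succ (suc x) zero) →
            Γ ⊢ ∃[ (λ g → Nat g ∧ g ∈ˢ suc y ∧ IsSuc g (suc y)) ] → Γ ⊢ RecExists succ x y
  RecExists-succ ax {x} {y} Nx Ny IH G =
    ∃Eᴬ {A = Nat zero ∧ zero ∈ˢ suc y ∧ IsSuc zero (suc y)} {B = RecExists succ x y} ax G λ ax₁ L₁ h →
    let p1 = L₁ Nx ; p2 = L₁ Ny ; p3 = L₁ IH
    in RecExists-next ax₁ {suc x} {suc y} {zero} p1 p2 (∧E₁ (∧E₂ h)) (∧E₂ (∧E₂ h))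
       (⇒E (⇒E (∀E p3 zero) (∧E₁ (∧E₂ h))) (∧E₁ h))

  recursion-step : Ax Γ → (x y : Fin n) → Γ ⊢ Nat x → Γ ⊢ Nat y →
            Γ ⊢ ∀̇ (zero ∈ˢ suc y ⇒ Nat zero ⇒ RecExists succ (suc x) zero) → Γ ⊢ RecExists succ x y
  recursion-step ax x y Nx Ny IH = ∨Eᴬ ax (Nat-cases Ny) (λ ax₁ W₁ e → RecExists-empty ax₁ (W₁ Nx) e) (λ ax₁ W₁ g → RecExists-succ ax₁ (W₁ Nx) (W₁ Ny) (W₁ IH) g)

  recursion : Ax Γ → (x y : Fin n) → Γ ⊢ Nat x → Γ ⊢ Nat y → Γ ⊢ RecExists succ x y
  recursion {Γ = Γ} ax x y Nx Ny = ⇒E (∀E (⇒E (closeS-elim (SetInduction (recursionF succ)) (λ _ → x) (ax (recursion∈ succ))) prem) y) Ny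
    where
    prem : Γ ⊢ ∀̇ (∀̇ (zero ∈ˢ suc zero ⇒ Nat zero ⇒ RecExists succ (suc (suc x)) zero) ⇒ Nat zero ⇒ RecExists succ (suc x) zero)
    prem = ∀Iᴬ ax λ ax₁ L₁ → ⇒Iᴬ ax₁ λ ax₂ W₂ ih → ⇒Iᴬ ax₂ λ ax₃ W₃ ny → let p1 = W₃ (W₂ (L₁ Nx)) ; p2 = W₃ ih in recursion-step ax₃ (suc x) zero p1 ny p2

  IsRec-RecFun : ∀ {x y f z : Fin n} → Γ ⊢ IsRec succ x y f z → Γ ⊢ RecFun succ x y z
  IsRec-RecFun {f = f} R = ∃I f (∧I (IsRec-functional R) (∧I (IsRec-base R) (∧I (IsRec-step R) (IsRec-value R))))

  RecSucc-from-Extends : Ax Γ → ∀ {x y s f z z' f' : Fin n} → Γ ⊢ Nat x → Γ ⊢ Nat y → Γ ⊢ IsSuc y s →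
    Γ ⊢ IsRec succ x y f z → Γ ⊢ Nat z' → Γ ⊢ StepRel succ x z z' → Γ ⊢ Extends f' f s z' → Γ ⊢ RecSucc succ x y s
  RecSucc-from-Extends ax {x} {y} {s} {f} {z} {z'} {f'} Nx Ny y⁺ R Nz' Szz' E =
    ∃I z (∃I z' (∧I (IsRec-Nat R) (∧I Nz' (∧I (IsRec-RecFun R)
       (∧I (IsRec-RecFun (IsRec-extend ax {x} {s} {y} {f} {z} {z'} {f'} Nx (Nat-IsSuc Ny y⁺) (IsSuc-self y⁺) y⁺ R Nz' Szz' E)) Szz')))))

  RecSucc-from-step : Ax Γ → ∀ {x y s f z z' : Fin n} → Γ ⊢ Nat x → Γ ⊢ Nat y → Γ ⊢ IsSuc y s →
    Γ ⊢ IsRec succ x y f z → Γ ⊢ Nat z' → Γ ⊢ StepRel succ x z z' → Γ ⊢ RecSucc succ x y s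
  RecSucc-from-step ax {x} {y} {s} {f} {z} {z'} Nx Ny y⁺ R Nz' Szz' =
    ∃Eᴬ {A = Extends zero (suc f) (suc s) (suc z')} {B = RecSucc succ x y s} ax (Extends-exists ax f s z') λ ax₁ L₁ e →
       let p1 = L₁ Nx ; p2 = L₁ Ny ; p3 = L₁ y⁺ ; p4 = L₁ R ; p5 = L₁ Nz' ; p6 = L₁ Szz'
       in RecSucc-from-Extends ax₁ {suc x} {suc y} {suc s} {suc f} {suc z} {suc z'} {zero} p1 p2 p3 p4 p5 p6 e

  RecSucc-from-IsRec : Ax Γ → ∀ {x y s f z : Fin n} → Γ ⊢ Nat x → Γ ⊢ Nat y → Γ ⊢ IsSuc y s →
    Γ ⊢ IsRec succ x y f z → Γ ⊢ RecSucc succ x y s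
  RecSucc-from-IsRec ax {x} {y} {s} {f} {z} Nx Ny y⁺ R =
    ∃Eᴬ {A = Nat zero ∧ StepRel succ (suc x) (suc z) zero} {B = RecSucc succ x y s} ax (StepRel-total ax {x} {z} Nx (IsRec-Nat R)) λ ax₁ L₁ h →
       let p1 = L₁ Nx ; p2 = L₁ Ny ; p3 = L₁ y⁺ ; p4 = L₁ R
       in RecSucc-from-step ax₁ {suc x} {suc y} {suc s} {suc f} {suc z} {zero} p1 p2 p3 p4 (∧E₁ h) (∧E₂ h)

  recursion-succ : Ax Γ → ∀ {x y s : Fin n} → Γ ⊢ Nat x → Γ ⊢ Nat y → Γ ⊢ IsSuc y s → Γ ⊢ RecSucc succ x y s
  recursion-succ ax {x} {y} {s} Nx Ny y⁺ =
    ∃Eᴬ {A = ∃̇ (IsRec succ (suc (suc x)) (suc (suc y)) (suc zero) zero)} {B = RecSucc succ x y s} ax (recursion ax x y Nx Ny) λ ax₁ L₁ ∃R →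
    ∃Eᴬ {A = IsRec succ (suc (suc x)) (suc (suc y)) (suc zero) zero} {B = RecSucc succ (suc x) (suc y) (suc s)} ax₁ ∃R λ ax₂ L₂ R →
       let p1 = L₂ (L₁ Nx) ; p2 = L₂ (L₁ Ny) ; p3 = L₂ (L₁ y⁺)
       in RecSucc-from-IsRec ax₂ {suc (suc x)} {suc (suc y)} {suc (suc s)} {suc zero} {zero} p1 p2 p3 R

IsAddFun : Fin n → Fin n → Fin n → Fin n → SFm n
IsAddFun a b c f = Functional f ∧ BaseClause succ a f ∧ StepClause succ a b f ∧ Holds f b c

AgreeAt : Fin n → Fin n → Fin n → SFm n
AgreeAt f g k = ∃[ (λ v → Holds (suc f) (suc k) v ∧ Holds (suc g) (suc k) v) ]

AgreeAt-next : Ax Γ → ∀ {a b f g j k v : Fin n} → Γ ⊢ StepClause succ a b f → Γ ⊢ StepClause succ a b g → Γ ⊢ j ∈ˢ b → Γ ⊢ IsSuc j k →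
  Γ ⊢ Holds f j v ∧ Holds g j v → Γ ⊢ AgreeAt f g k
AgreeAt-next ax {a} {v = v} Sf Sg jb jk H = ∃Eᴬ {A = IsSuc (suc v) zero} ax (IsSuc-exists ax v) λ ax₁ L₁ sv →
  let p1 = L₁ Sf ; p2 = L₁ jb ; p3 = L₁ jk ; p4 = L₁ (∧E₁ H) ; p5 = L₁ Sg ; p6 = L₁ (∧E₂ H)
  in ∃I zero (∧I (Addition.StepClause-elim {x = suc a} p1 p2 p3 p4 sv) (Addition.StepClause-elim {x = suc a} p5 p2 p3 p6 sv))

AgreeAt-succ : Ax Γ → ∀ {a b f g j k : Fin n} → Γ ⊢ Trans b → Γ ⊢ StepClause succ a b f → Γ ⊢ StepClause succ a b g →
  Γ ⊢ ∀̇ (zero ∈ˢ suc k ⇒ ((zero ∈ˢ suc b ∨ zero ≐ suc b) ⇒ AgreeAt (suc f) (suc g) zero)) →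
  Γ ⊢ (k ∈ˢ b ∨ k ≐ b) → Γ ⊢ j ∈ˢ k → Γ ⊢ IsSuc j k → Γ ⊢ AgreeAt f g k
AgreeAt-succ {Γ = Γ} ax {a} {b} {f} {g} {j} {k} Tb Sf Sg IH kb jk jS =
  ∃Eᴬ {A = Holds (suc f) (suc j) zero ∧ Holds (suc g) (suc j) zero} ax (⇒E (⇒E (∀E IH j) jk) (∨I₁ jb)) λ ax₁ L₁ h →
  let p1 = L₁ Sf ; p2 = L₁ Sg ; p3 = L₁ jb ; p4 = L₁ jS in AgreeAt-next ax₁ {a = suc a} p1 p2 p3 p4 h
  where
  jb : Γ ⊢ j ∈ˢ b
  jb = ∨E′ kb (λ W h → let t = W Tb ; q = W jk in Trans-∈ t h q) (λ W h → let q = W jk in ∈-respʳ h q)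

AgreeAt-induction-step : Ax Γ → ∀ {a b f g k : Fin n} → Γ ⊢ Nat b → Γ ⊢ BaseClause succ a f → Γ ⊢ BaseClause succ a g →
  Γ ⊢ StepClause succ a b f → Γ ⊢ StepClause succ a b g →
  Γ ⊢ ∀̇ (zero ∈ˢ suc k ⇒ ((zero ∈ˢ suc b ∨ zero ≐ suc b) ⇒ AgreeAt (suc f) (suc g) zero)) →
  Γ ⊢ (k ∈ˢ b ∨ k ≐ b) → Γ ⊢ AgreeAt f g k
AgreeAt-induction-step {Γ = Γ} ax {a} {b} {f} {g} {k} Nb Bf Bg Sf Sg IH kb =
  ∨Eᴬ ax (Nat-cases Nk)
     (λ ax₁ W₁ ek → let q1 = W₁ Bf ; q2 = W₁ Bg in ∃I a (∧I (⇒E (∀E q1 k) ek) (⇒E (∀E q2 k) ek)))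
     (λ ax₁ W₁ G → ∃Eᴬ {A = Nat zero ∧ zero ∈ˢ suc k ∧ IsSuc zero (suc k)} ax₁ G λ ax₂ L₂ h →
         let p1 = L₂ (W₁ (∧E₁ (∧E₁ Nb))) ; p2 = L₂ (W₁ Sf) ; p3 = L₂ (W₁ Sg) ; p4 = L₂ (W₁ IH) ; p5 = L₂ (W₁ kb)
         in AgreeAt-succ ax₂ {a = suc a} p1 p2 p3 p4 p5 (∧E₁ (∧E₂ h)) (∧E₂ (∧E₂ h)))
  where
  Nk : Γ ⊢ Nat k
  Nk = ∨E′ kb (λ W h → let nb = W Nb in Nat-∈ nb h) (λ W h → let nb = W Nb in ≐subst (Nat zero) (≐sym h) nb)

IsAddFun-unique : Ax Γ → ∀ {a b c c' f g : Fin n} → Γ ⊢ Nat b → Γ ⊢ IsAddFun a b c f → Γ ⊢ IsAddFun a b c' g → Γ ⊢ c ≐ c'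
IsAddFun-unique {Γ = Γ} ax {a} {b} {c} {c'} {f} {g} Nb FF GG =
  ∃Eᴬ {A = Holds (suc f) (suc b) zero ∧ Holds (suc g) (suc b) zero} ax (⇒E (∀E (⇒E si prem) b) (∨I₂ (≐refl b))) λ ax₁ L₁ h →
    let p1 = L₁ (∧E₁ FF) ; p2 = L₁ (∧E₂ (∧E₂ (∧E₂ FF))) ; p3 = L₁ (∧E₁ GG) ; p4 = L₁ (∧E₂ (∧E₂ (∧E₂ GG)))
    in ≐trans (Functional-elim p1 p2 (∧E₁ h)) (≐sym (Functional-elim p3 p4 (∧E₂ h)))
  where
  si = closeS-elim (SetInduction agreementF) (λ { zero → a ; (suc zero) → b ; (suc (suc zero)) → f ; (suc (suc (suc zero))) → g }) (ax agreement∈)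
  prem : Γ ⊢ ∀̇ (∀̇ (zero ∈ˢ suc zero ⇒ ((zero ∈ˢ suc (suc b) ∨ zero ≐ suc (suc b)) ⇒ AgreeAt (suc (suc f)) (suc (suc g)) zero))
               ⇒ ((zero ∈ˢ suc b ∨ zero ≐ suc b) ⇒ AgreeAt (suc f) (suc g) zero))
  prem = ∀Iᴬ ax λ ax₁ L₁ → ⇒Iᴬ ax₁ λ ax₂ W₂ ih → ⇒Iᴬ ax₂ λ ax₃ W₃ kb →
    let p1 = W₃ (W₂ (L₁ Nb)) ; p2 = W₃ (W₂ (L₁ (∧E₁ (∧E₂ FF)))) ; p3 = W₃ (W₂ (L₁ (∧E₁ (∧E₂ GG))))
        p4 = W₃ (W₂ (L₁ (∧E₁ (∧E₂ (∧E₂ FF))))) ; p5 = W₃ (W₂ (L₁ (∧E₁ (∧E₂ (∧E₂ GG))))) ; p6 = W₃ ih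
    in AgreeAt-induction-step ax₃ p1 p2 p3 p4 p5 p6 kb

AddF-unique : Ax Γ → ∀ {a b c c' : Fin n} → Γ ⊢ Nat b → Γ ⊢ AddF a b c → Γ ⊢ AddF a b c' → Γ ⊢ c ≐ c'
AddF-unique ax {a} {b} {c} {c'} Nb d1 d2 =
  ∃Eᴬ {A = IsAddFun (suc a) (suc b) (suc c) zero} ax d1 λ ax₁ L₁ F →
  let d2' = L₁ d2 in
  ∃Eᴬ {A = IsAddFun (suc (suc a)) (suc (suc b)) (suc (suc c')) zero} ax₁ d2' λ ax₂ L₂ G →
  let nb = L₂ (L₁ Nb) ; F' = L₂ F in IsAddFun-unique ax₂ nb F' G

AddF-total : Ax Γ → ∀ {x v : Fin n} → Γ ⊢ Nat x → Γ ⊢ Nat v → Γ ⊢ ∃[ (λ w → Nat w ∧ AddF (suc v) (suc x) w) ]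
AddF-total ax {x} {v} Nx Nv =
  ∃Eᴬ {A = ∃̇ (IsRec succ (suc (suc v)) (suc (suc x)) (suc zero) zero)} ax (Addition.recursion ax v x Nv Nx) λ ax₁ L₁ ∃R →
  ∃Eᴬ {A = IsRec succ (suc (suc v)) (suc (suc x)) (suc zero) zero} ax₁ ∃R λ ax₂ L₂ R →
  ∃I zero (∧I (IsRec-Nat R) (∃I (suc zero) (∧I (IsRec-functional R) (∧I (IsRec-base R) (∧I (IsRec-step R) (IsRec-value R))))))

-- The development of Addition repeated with the step plus: renaming and instantiation
-- compute through StepRel only when the step is known.
module Multiplication where

  StepRel-total : Ax Γ → ∀ {x v : Fin n} → Γ ⊢ Nat x → Γ ⊢ Nat v → Γ ⊢ ∃[ (λ w → Nat w ∧ StepRel plus (suc x) (suc v) w) ]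
  StepRel-total = AddF-total

  StepRel-unique : Ax Γ → ∀ {x v w w' : Fin n} → Γ ⊢ Nat x → Γ ⊢ StepRel plus x v w → Γ ⊢ StepRel plus x v w' → Γ ⊢ w ≐ w'
  StepRel-unique ax Nx = AddF-unique ax Nx

  baseValue-resp : ∀ {x e y : Fin n} → Γ ⊢ e ≐ y → Γ ⊢ baseValue plus x e ≐ baseValue plus x y
  baseValue-resp e≐y = e≐y

  Nat-baseValue : ∀ {x y : Fin n} → Γ ⊢ Nat x → Γ ⊢ Empty y → Γ ⊢ Nat (baseValue plus x y)
  Nat-baseValue _ Ey = Nat-Empty Ey

  StepRel-resp : ∀ {x v v' w : Fin n} → Γ ⊢ v ≐ v' → Γ ⊢ StepRel plus x v w → Γ ⊢ StepRel plus x v' w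
  StepRel-resp {x = x} {w = w} e d = ≐subst (StepRel plus (suc x) zero (suc w)) e d

  StepClause-elim : ∀ {x y f k k₁ v v₁ : Fin n} → Γ ⊢ StepClause plus x y f → Γ ⊢ k ∈ˢ y → Γ ⊢ IsSuc k k₁ →
            Γ ⊢ Holds f k v → Γ ⊢ StepRel plus x v v₁ → Γ ⊢ Holds f k₁ v₁
  StepClause-elim {k = k} {k₁} {v} {v₁} S a b c d = ⇒E (∀E (⇒E (∀E (⇒E (∀E (⇒E (∀E S k) a) k₁) b) v) c) v₁) d

  BaseClause-elim : ∀ {x f e : Fin n} → Γ ⊢ BaseClause plus x f → Γ ⊢ Empty e → Γ ⊢ Holds f e (baseValue plus x e)
  BaseClause-elim {e = e} B E = ⇒E (∀E B e) E

  Extends-step : Ax Γ → ∀ {x y g f z z' f' k k₁ v v₁ : Fin n} → Γ ⊢ Nat x → Γ ⊢ IsSuc g y →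
    Γ ⊢ Functional f → Γ ⊢ StepClause plus x g f → Γ ⊢ Holds f g z → Γ ⊢ StepRel plus x z z' → Γ ⊢ Extends f' f y z' →
    Γ ⊢ k ∈ˢ y → Γ ⊢ IsSuc k k₁ → Γ ⊢ Holds f' k v → Γ ⊢ StepRel plus x v v₁ → Γ ⊢ Holds f' k₁ v₁
  Extends-step ax {x} {y} {k₁ = k₁} Nx g⁺ F S H s E k∈y k⁺ hk sv =
    ∨E (Extends-⁻ E hk)
       (∨E (IsSuc-∈⁻ (⊢∷ g⁺) (⊢∷ k∈y))
           (Extends-⁺ (⊢∷∷ E) (∨I₁ (StepClause-elim {x = x} (⊢∷∷ S) hyp₀ (⊢∷∷ k⁺) hyp₁ (⊢∷∷ sv))))
           (Extends-⁺ (⊢∷∷ E) (∨I₂ (∧I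
             (≐sym (IsSuc-unique ax″ (⊢∷∷ g⁺) (≐subst (IsSuc zero (suc k₁)) hyp₀ (⊢∷∷ k⁺))))
             (StepRel-unique ax″ (⊢∷∷ Nx)
               (StepRel-resp {x = x} (Functional-elim (⊢∷∷ F) (Holds-respˡ hyp₀ hyp₁) (⊢∷∷ H)) (⊢∷∷ sv))
               (⊢∷∷ s))))))
       (⊥E (∈-irrefl (Ax-∷ ax) y (∈-respˡ (∧E₁ hyp₀) (⊢∷ k∈y))))
    where
    ax″ = Ax-∷ (Ax-∷ ax)

  IsRec-extend : Ax Γ → ∀ {x y g f z z' f' : Fin n} → Γ ⊢ Nat x → Γ ⊢ Nat y → Γ ⊢ g ∈ˢ y →
    Γ ⊢ IsSuc g y → Γ ⊢ IsRec plus x g f z → Γ ⊢ Nat z' → Γ ⊢ StepRel plus x z z' → Γ ⊢ Extends f' f y z' →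
    Γ ⊢ IsRec plus x y f' z'
  IsRec-extend {Γ = Γ} ax {x} {y} {g} {f} {z} {z'} {f'} Nx Ny g∈y g⁺ R Nz' Szz' E =
    ∧I (Extends-Functional (IsRec-functional R) undefined E)
    (∧I base (∧I step (∧I (Extends-⁺ E (∨I₂ (∧I (≐refl y) (≐refl z')))) (∧I Nz' domain))))
    where
    Ty : Γ ⊢ Trans y
    Ty = ∧E₁ (∧E₁ Ny)
    Dom : Γ ⊢ DomainBound f g
    Dom = IsRec-domain R
    undefined : Γ ⊢ Undefined f y
    undefined = ∀Iᴬ ax λ ax₁ L₁ → ∀Iᴬ ax₁ λ ax₂ L₂ → ⇒Iᴬ ax₂ λ ax₃ W₃ hf′ → ⇒Iᴬ ax₃ λ ax₄ W₄ k≐y →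
       let q1 = W₄ (W₃ (L₂ (L₁ Dom))) ; q2 = W₄ hf′ ; q3 = W₄ (W₃ (L₂ (L₁ Ty))) ; q4 = W₄ (W₃ (L₂ (L₁ g∈y))) in
       ∨Eᴬ ax₄ (DomainBound-elim q1 q2)
          (λ ax₅ W₅ kg → let r1 = W₅ q3 ; r2 = W₅ q4 ; r3 = W₅ k≐y in ∈-irrefl ax₅ (suc (suc y)) (Trans-∈ r1 r2 (∈-respˡ r3 kg)))
          (λ ax₅ W₅ kg → let r2 = W₅ q4 ; r3 = W₅ k≐y in ∈-irrefl ax₅ (suc (suc y)) (∈-respˡ (≐trans (≐sym kg) r3) r2))
    base : Γ ⊢ BaseClause plus x f'
    base = ∀Iᴬ ax λ ax₁ L₁ → ⇒Iᴬ ax₁ λ ax₂ W₂ e → let q1 = W₂ (L₁ E) ; q2 = W₂ (L₁ (IsRec-base R)) in Extends-⁺ q1 (∨I₁ (BaseClause-elim {x = suc x} q2 e))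
    domain : Γ ⊢ DomainBound f' y
    domain = ∀Iᴬ ax λ ax₁ L₁ → ∀Iᴬ ax₁ λ ax₂ L₂ → ⇒Iᴬ ax₂ λ ax₃ W₃ hf′ →
       let q1 = W₃ (L₂ (L₁ E)) ; q2 = W₃ (L₂ (L₁ Dom)) ; q3 = W₃ (L₂ (L₁ Ty)) ; q4 = W₃ (L₂ (L₁ g∈y)) in
       ∨Eᴬ ax₃ (Extends-⁻ q1 hf′)
       (λ ax₄ W₄ hf → let r2 = W₄ q2 ; r3 = W₄ q3 ; r4 = W₄ q4 in ∨I₁ (∨Eᴬ ax₄ (DomainBound-elim r2 hf)
           (λ ax₅ W₅ kg → let u3 = W₅ r3 ; u4 = W₅ r4 in Trans-∈ u3 u4 kg)
           (λ ax₅ W₅ kg → let u4 = W₅ r4 in ∈-respˡ (≐sym kg) u4)))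
       (λ ax₄ W₄ e → ∨I₂ (∧E₁ e))
    step : Γ ⊢ StepClause plus x y f'
    step = ∀Iᴬ ax λ ax₁ L₁ → ⇒Iᴬ ax₁ λ ax₂ W₂ k∈y → ∀Iᴬ ax₂ λ ax₃ L₃ → ⇒Iᴬ ax₃ λ ax₄ W₄ k⁺ → ∀Iᴬ ax₄ λ ax₅ L₅ → ⇒Iᴬ ax₅ λ ax₆ W₆ hk →
            ∀Iᴬ ax₆ λ ax₇ L₇ → ⇒Iᴬ ax₇ λ ax₈ W₈ sv →
      let p1 = W₈ (L₇ (W₆ (L₅ (W₄ (L₃ (W₂ (L₁ (Nx))))))))
          p2 = W₈ (L₇ (W₆ (L₅ (W₄ (L₃ (W₂ (L₁ (g⁺))))))))
          p3 = W₈ (L₇ (W₆ (L₅ (W₄ (L₃ (W₂ (L₁ (IsRec-functional R))))))))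
          p4 = W₈ (L₇ (W₆ (L₅ (W₄ (L₃ (W₂ (L₁ (IsRec-step R))))))))
          p5 = W₈ (L₇ (W₆ (L₅ (W₄ (L₃ (W₂ (L₁ (IsRec-value R))))))))
          p6 = W₈ (L₇ (W₆ (L₅ (W₄ (L₃ (W₂ (L₁ (Szz'))))))))
          p7 = W₈ (L₇ (W₆ (L₅ (W₄ (L₃ (W₂ (L₁ (E))))))))
          p8 = W₈ (L₇ (W₆ (L₅ (W₄ (L₃ k∈y)))))
          p9 = W₈ (L₇ (W₆ (L₅ k⁺)))
          p10 = W₈ (L₇ hk)
      in Extends-step ax₈ {suc (suc (suc (suc x)))} {suc (suc (suc (suc y)))} {suc (suc (suc (suc g)))} {suc (suc (suc (suc f)))}
        {suc (suc (suc (suc z)))} {suc (suc (suc (suc z')))} {suc (suc (suc (suc f')))}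
        {suc (suc (suc zero))} {suc (suc zero)} {suc zero} {zero}
        p1 p2 p3 p4 p5 p6 p7 p8 p9 p10 sv

  IsRec-empty : Ax Γ → ∀ {x y f' : Fin n} → Γ ⊢ Nat x → Γ ⊢ Empty y → Γ ⊢ Extends f' y y (baseValue plus x y) →
    Γ ⊢ IsRec plus x y f' (baseValue plus x y)
  IsRec-empty {Γ = Γ} ax {x} {y} {f'} Nx Ey E =
    ∧I (Extends-Functional y-functional y-undefined E) (∧I base (∧I step (∧I (Extends-⁺ E (∨I₂ (∧I (≐refl y) (≐refl _)))) (∧I (Nat-baseValue Nx Ey) domain))))
    where
    y-functional : Γ ⊢ Functional y
    y-functional = ∀I′ λ L₁ → ∀I′ λ L₂ → ∀I′ λ L₃ → ⇒I′ λ W₄ hA → ⇒I′ λ W₅ hB → let q = W₅ (W₄ (L₃ (L₂ (L₁ Ey)))) ; q' = W₅ hA in ⊥E (Holds-Empty q q')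
    y-undefined : Γ ⊢ Undefined y y
    y-undefined = ∀I′ λ L₁ → ∀I′ λ L₂ → ⇒I′ λ W₃ hA → ⇒I′ λ W₄ e → let q = W₄ (W₃ (L₂ (L₁ Ey))) ; q' = W₄ hA in ⊥E (Holds-Empty q q')
    base : Γ ⊢ BaseClause plus x f'
    base = ∀Iᴬ ax λ ax₁ L₁ → ⇒Iᴬ ax₁ λ ax₂ W₂ ee →
      let q1 = W₂ (L₁ E) ; q2 = W₂ (L₁ Ey) in
      Extends-⁺ q1 (∨I₂ (∧I (Empty-unique ax₂ ee q2) (baseValue-resp {x = suc x} (Empty-unique ax₂ ee q2))))
    step : Γ ⊢ StepClause plus x y f'
    step = ∀I′ λ L₁ → ⇒I′ λ W₂ k∈y → let q = W₂ (L₁ Ey) in ⊥E (Empty-∉ q k∈y)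
    domain : Γ ⊢ DomainBound f' y
    domain = ∀I′ λ L₁ → ∀I′ λ L₂ → ⇒I′ λ W₃ hA → let q1 = W₃ (L₂ (L₁ E)) ; q2 = W₃ (L₂ (L₁ Ey)) in ∨E′ (Extends-⁻ q1 hA)
       (λ W₄ hf → let r = W₄ q2 in ⊥E (Holds-Empty r hf)) (λ W₄ e → ∨I₂ (∧E₁ e))

  RecExists-from-step : Ax Γ → ∀ {x y g f z z' : Fin n} → Γ ⊢ Nat x → Γ ⊢ Nat y → Γ ⊢ g ∈ˢ y → Γ ⊢ IsSuc g y →
    Γ ⊢ IsRec plus x g f z → Γ ⊢ Nat z' → Γ ⊢ StepRel plus x z z' → Γ ⊢ RecExists plus x y
  RecExists-from-step ax {x} {y} {g} {f} {z} {z'} Nx Ny g∈y g⁺ R Nz' Szz' =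
    ∃Eᴬ {A = Extends zero (suc f) (suc y) (suc z')} {B = RecExists plus x y} ax (Extends-exists ax f y z') λ ax₁ L₁ e →
      let p1 = L₁ Nx ; p2 = L₁ Ny ; p3 = L₁ g∈y ; p4 = L₁ g⁺ ; p5 = L₁ R ; p6 = L₁ Nz' ; p7 = L₁ Szz'
      in ∃I zero (∃I (suc z')
         (IsRec-extend ax₁ {suc x} {suc y} {suc g} {suc f} {suc z} {suc z'} {zero} p1 p2 p3 p4 p5 p6 p7 e))

  RecExists-from-IsRec : Ax Γ → ∀ {x y g f z : Fin n} → Γ ⊢ Nat x → Γ ⊢ Nat y → Γ ⊢ g ∈ˢ y → Γ ⊢ IsSuc g y →
    Γ ⊢ IsRec plus x g f z → Γ ⊢ RecExists plus x y
  RecExists-from-IsRec ax {x} {y} {g} {f} {z} Nx Ny g∈y g⁺ R =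
    ∃Eᴬ {A = Nat zero ∧ StepRel plus (suc x) (suc z) zero} {B = RecExists plus x y} ax (StepRel-total ax {x} {z} Nx (IsRec-Nat R)) λ ax₁ L₁ h →
       let p1 = L₁ Nx ; p2 = L₁ Ny ; p3 = L₁ g∈y ; p4 = L₁ g⁺ ; p5 = L₁ R
       in RecExists-from-step ax₁ {suc x} {suc y} {suc g} {suc f} {suc z} {zero} p1 p2 p3 p4 p5 (∧E₁ h) (∧E₂ h)

  RecExists-next : Ax Γ → ∀ {x y g : Fin n} → Γ ⊢ Nat x → Γ ⊢ Nat y → Γ ⊢ g ∈ˢ y → Γ ⊢ IsSuc g y →
    Γ ⊢ RecExists plus x g → Γ ⊢ RecExists plus x y
  RecExists-next ax {x} {y} {g} Nx Ny g∈y g⁺ RE =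
    ∃Eᴬ {A = ∃̇ (IsRec plus (suc (suc x)) (suc (suc g)) (suc zero) zero)} {B = RecExists plus x y} ax RE λ ax₁ L₁ ∃R →
    ∃Eᴬ {A = IsRec plus (suc (suc x)) (suc (suc g)) (suc zero) zero} {B = RecExists plus (suc x) (suc y)} ax₁ ∃R λ ax₂ L₂ R →
      let p1 = L₂ (L₁ Nx) ; p2 = L₂ (L₁ Ny) ; p3 = L₂ (L₁ g∈y) ; p4 = L₂ (L₁ g⁺)
      in RecExists-from-IsRec ax₂ {suc (suc x)} {suc (suc y)} {suc (suc g)} {suc zero} {zero} p1 p2 p3 p4 R

  RecExists-empty : Ax Γ → ∀ {x y : Fin n} → Γ ⊢ Nat x → Γ ⊢ Empty y → Γ ⊢ RecExists plus x y
  RecExists-empty ax {x} {y} Nx Ey =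
    ∃Eᴬ {A = Extends zero (suc y) (suc y) (suc (baseValue plus x y))} {B = RecExists plus x y} ax (Extends-exists ax y y (baseValue plus x y)) λ ax₁ L₁ e →
      let p1 = L₁ Nx ; p2 = L₁ Ey in ∃I zero (∃I (baseValue plus (suc x) (suc y)) (IsRec-empty ax₁ p1 p2 e))

  RecExists-succ : Ax Γ → ∀ {x y : Fin n} → Γ ⊢ Nat x → Γ ⊢ Nat y →
            Γ ⊢ ∀̇ (zero ∈ˢ suc y ⇒ Nat zero ⇒ RecExists plus (suc x) zero) →
            Γ ⊢ ∃[ (λ g → Nat g ∧ g ∈ˢ suc y ∧ IsSuc g (suc y)) ] → Γ ⊢ RecExists plus x y
  RecExists-succ ax {x} {y} Nx Ny IH G =
    ∃Eᴬ {A = Nat zero ∧ zero ∈ˢ suc y ∧ IsSuc zero (suc y)} {B = RecExists plus x y} ax G λ ax₁ L₁ h →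
    let p1 = L₁ Nx ; p2 = L₁ Ny ; p3 = L₁ IH
    in RecExists-next ax₁ {suc x} {suc y} {zero} p1 p2 (∧E₁ (∧E₂ h)) (∧E₂ (∧E₂ h))
       (⇒E (⇒E (∀E p3 zero) (∧E₁ (∧E₂ h))) (∧E₁ h))

  recursion-step : Ax Γ → (x y : Fin n) → Γ ⊢ Nat x → Γ ⊢ Nat y →
            Γ ⊢ ∀̇ (zero ∈ˢ suc y ⇒ Nat zero ⇒ RecExists plus (suc x) zero) → Γ ⊢ RecExists plus x y
  recursion-step ax x y Nx Ny IH = ∨Eᴬ ax (Nat-cases Ny) (λ ax₁ W₁ e → RecExists-empty ax₁ (W₁ Nx) e) (λ ax₁ W₁ g → RecExists-succ ax₁ (W₁ Nx) (W₁ Ny) (W₁ IH) g)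

  recursion : Ax Γ → (x y : Fin n) → Γ ⊢ Nat x → Γ ⊢ Nat y → Γ ⊢ RecExists plus x y
  recursion {Γ = Γ} ax x y Nx Ny = ⇒E (∀E (⇒E (closeS-elim (SetInduction (recursionF plus)) (λ _ → x) (ax (recursion∈ plus))) prem) y) Ny
    where
    prem : Γ ⊢ ∀̇ (∀̇ (zero ∈ˢ suc zero ⇒ Nat zero ⇒ RecExists plus (suc (suc x)) zero) ⇒ Nat zero ⇒ RecExists plus (suc x) zero)
    prem = ∀Iᴬ ax λ ax₁ L₁ → ⇒Iᴬ ax₁ λ ax₂ W₂ ih → ⇒Iᴬ ax₂ λ ax₃ W₃ ny → let p1 = W₃ (W₂ (L₁ Nx)) ; p2 = W₃ ih in recursion-step ax₃ (suc x) zero p1 ny p2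

  IsRec-RecFun : ∀ {x y f z : Fin n} → Γ ⊢ IsRec plus x y f z → Γ ⊢ RecFun plus x y z
  IsRec-RecFun {f = f} R = ∃I f (∧I (IsRec-functional R) (∧I (IsRec-base R) (∧I (IsRec-step R) (IsRec-value R))))

  RecSucc-from-Extends : Ax Γ → ∀ {x y s f z z' f' : Fin n} → Γ ⊢ Nat x → Γ ⊢ Nat y → Γ ⊢ IsSuc y s →
    Γ ⊢ IsRec plus x y f z → Γ ⊢ Nat z' → Γ ⊢ StepRel plus x z z' → Γ ⊢ Extends f' f s z' → Γ ⊢ RecSucc plus x y s
  RecSucc-from-Extends ax {x} {y} {s} {f} {z} {z'} {f'} Nx Ny y⁺ R Nz' Szz' E =
    ∃I z (∃I z' (∧I (IsRec-Nat R) (∧I Nz' (∧I (IsRec-RecFun R)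
       (∧I (IsRec-RecFun (IsRec-extend ax {x} {s} {y} {f} {z} {z'} {f'} Nx (Nat-IsSuc Ny y⁺) (IsSuc-self y⁺) y⁺ R Nz' Szz' E)) Szz')))))

  RecSucc-from-step : Ax Γ → ∀ {x y s f z z' : Fin n} → Γ ⊢ Nat x → Γ ⊢ Nat y → Γ ⊢ IsSuc y s →
    Γ ⊢ IsRec plus x y f z → Γ ⊢ Nat z' → Γ ⊢ StepRel plus x z z' → Γ ⊢ RecSucc plus x y s
  RecSucc-from-step ax {x} {y} {s} {f} {z} {z'} Nx Ny y⁺ R Nz' Szz' =
    ∃Eᴬ {A = Extends zero (suc f) (suc s) (suc z')} {B = RecSucc plus x y s} ax (Extends-exists ax f s z') λ ax₁ L₁ e →
       let p1 = L₁ Nx ; p2 = L₁ Ny ; p3 = L₁ y⁺ ; p4 = L₁ R ; p5 = L₁ Nz' ; p6 = L₁ Szz'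
       in RecSucc-from-Extends ax₁ {suc x} {suc y} {suc s} {suc f} {suc z} {suc z'} {zero} p1 p2 p3 p4 p5 p6 e

  RecSucc-from-IsRec : Ax Γ → ∀ {x y s f z : Fin n} → Γ ⊢ Nat x → Γ ⊢ Nat y → Γ ⊢ IsSuc y s →
    Γ ⊢ IsRec plus x y f z → Γ ⊢ RecSucc plus x y s
  RecSucc-from-IsRec ax {x} {y} {s} {f} {z} Nx Ny y⁺ R =
    ∃Eᴬ {A = Nat zero ∧ StepRel plus (suc x) (suc z) zero} {B = RecSucc plus x y s} ax (StepRel-total ax {x} {z} Nx (IsRec-Nat R)) λ ax₁ L₁ h →
       let p1 = L₁ Nx ; p2 = L₁ Ny ; p3 = L₁ y⁺ ; p4 = L₁ R
       in RecSucc-from-step ax₁ {suc x} {suc y} {suc s} {suc f} {suc z} {zero} p1 p2 p3 p4 (∧E₁ h) (∧E₂ h)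

  recursion-succ : Ax Γ → ∀ {x y s : Fin n} → Γ ⊢ Nat x → Γ ⊢ Nat y → Γ ⊢ IsSuc y s → Γ ⊢ RecSucc plus x y s
  recursion-succ ax {x} {y} {s} Nx Ny y⁺ =
    ∃Eᴬ {A = ∃̇ (IsRec plus (suc (suc x)) (suc (suc y)) (suc zero) zero)} {B = RecSucc plus x y s} ax (recursion ax x y Nx Ny) λ ax₁ L₁ ∃R →
    ∃Eᴬ {A = IsRec plus (suc (suc x)) (suc (suc y)) (suc zero) zero} {B = RecSucc plus (suc x) (suc y) (suc s)} ax₁ ∃R λ ax₂ L₂ R →
       let p1 = L₂ (L₁ Nx) ; p2 = L₂ (L₁ Ny) ; p3 = L₂ (L₁ y⁺)
       in RecSucc-from-IsRec ax₂ {suc (suc x)} {suc (suc y)} {suc (suc s)} {suc zero} {zero} p1 p2 p3 R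

⟦x≡y⟧ : ∀ {x y : Fin n} → Γ ⊢ Nat x → Γ ⊢ Nat y → Γ ⊢ x ≐ y → Γ ⊢ ⟦ var x ≡ᵃ var y ⟧ᵒ
⟦x≡y⟧ {x = x} {y} Nx Ny e = ∃I x (∃I y (∧I Nx (∧I Ny (∧I (≐refl x) (∧I (≐refl y) e)))))

≐-IsSuc-injective : Ax Γ → ∀ {x y a b u w : Fin n} → Γ ⊢ Nat a → Γ ⊢ a ≐ x → Γ ⊢ IsSuc a u → Γ ⊢ b ≐ y → Γ ⊢ IsSuc b w →
  Γ ⊢ u ≐ w → Γ ⊢ x ≐ y
≐-IsSuc-injective ax {b = b} Na a≐x a⁺ b≐y b⁺ u≐w =
  ≐trans (≐sym a≐x) (≐trans (IsSuc-injective ax (∧E₁ (∧E₁ Na)) a⁺ (≐subst (IsSuc (suc b) zero) (≐sym u≐w) b⁺)) b≐y)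

⟦Sx≡Sy⟧-injective′ : Ax Γ → ∀ {x y u w : Fin n} →
  Γ ⊢ Nat u ∧ Nat w ∧ ∃̇ (Nat zero ∧ zero ≐ suc x ∧ IsSuc zero (suc u)) ∧ ∃̇ (Nat zero ∧ zero ≐ suc y ∧ IsSuc zero (suc w)) ∧ u ≐ w →
  Γ ⊢ x ≐ y
⟦Sx≡Sy⟧-injective′ ax {x} {y} {u} {w} B =
  ∃Eᴬ {A = Nat zero ∧ zero ≐ suc x ∧ IsSuc zero (suc u)} {B = x ≐ y} ax (∧E₁ (∧E₂ (∧E₂ B))) λ ax₁ L₁ ha →
  let q = L₁ (∧E₁ (∧E₂ (∧E₂ (∧E₂ B)))) in
  ∃Eᴬ {A = Nat zero ∧ zero ≐ suc (suc y) ∧ IsSuc zero (suc (suc w))} {B = suc x ≐ suc y} ax₁ q λ ax₂ L₂ hb →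
  let p1 = L₂ (∧E₁ ha) ; p2 = L₂ (∧E₁ (∧E₂ ha)) ; p3 = L₂ (∧E₂ (∧E₂ ha)) ; p4 = L₂ (L₁ (∧E₂ (∧E₂ (∧E₂ (∧E₂ B)))))
  in ≐-IsSuc-injective ax₂ p1 p2 p3 (∧E₁ (∧E₂ hb)) (∧E₂ (∧E₂ hb)) p4

⟦Sx≡Sy⟧-injective : Ax Γ → ∀ {x y : Fin n} → Γ ⊢ ⟦ 𝐒 (var x) ≡ᵃ 𝐒 (var y) ⟧ᵒ → Γ ⊢ x ≐ y
⟦Sx≡Sy⟧-injective ax {x} {y} H =
  ∃Eᴬ {A = ∃̇ (Nat (suc zero) ∧ Nat zero ∧ ∃̇ (Nat zero ∧ zero ≐ suc (suc (suc x)) ∧ IsSuc zero (suc (suc zero)))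
                ∧ ∃̇ (Nat zero ∧ zero ≐ suc (suc (suc y)) ∧ IsSuc zero (suc zero)) ∧ suc zero ≐ zero)} {B = x ≐ y} ax H λ ax₁ L₁ ∃R →
  ∃Eᴬ {A = Nat (suc zero) ∧ Nat zero ∧ ∃̇ (Nat zero ∧ zero ≐ suc (suc (suc x)) ∧ IsSuc zero (suc (suc zero)))
                ∧ ∃̇ (Nat zero ∧ zero ≐ suc (suc (suc y)) ∧ IsSuc zero (suc zero)) ∧ suc zero ≐ zero} {B = suc x ≐ suc y} ax₁ ∃R λ ax₂ L₂ R →
  ⟦Sx≡Sy⟧-injective′ ax₂ R

succInj-sound : ∀ {Γ : List (SFm 0)} → Ax Γ →
  Γ ⊢ ⟦ ∀ᵃ (∀ᵃ (𝐒 (var (suc zero)) ≡ᵃ 𝐒 (var zero) ⇒ᵃ var (suc zero) ≡ᵃ var zero)) ⟧ᵒ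
succInj-sound ax = ∀Iᴬ ax λ ax₁ L₁ → ⇒Iᴬ ax₁ λ ax₂ W₂ nx → ∀Iᴬ ax₂ λ ax₃ L₃ → ⇒Iᴬ ax₃ λ ax₄ W₄ ny → ⇒Iᴬ ax₄ λ ax₅ W₅ H →
  let nx' = W₅ (W₄ (L₃ nx)) ; ny' = W₅ ny in ⟦x≡y⟧ nx' ny' (⟦Sx≡Sy⟧-injective ax₅ H)

⟦x≡0⟧ : ∀ {x : Fin n} → Γ ⊢ Nat x → Γ ⊢ Empty x → Γ ⊢ ⟦ var x ≡ᵃ 𝟎 ⟧ᵒ
⟦x≡0⟧ {x = x} Nx Ex = ∃I x (∃I x (∧I Nx (∧I Nx (∧I (≐refl x) (∧I Ex (≐refl x))))))

⟦x≡Sg⟧ : ∀ {x g : Fin n} → Γ ⊢ Nat x → Γ ⊢ Nat g → Γ ⊢ IsSuc g x → Γ ⊢ ⟦ var x ≡ᵃ 𝐒 (var g) ⟧ᵒ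
⟦x≡Sg⟧ {x = x} {g} Nx Ng S = ∃I x (∃I x (∧I Nx (∧I Nx (∧I (≐refl x) (∧I (∃I g (∧I Ng (∧I (≐refl g) S))) (≐refl x))))))

⟦x≡0∨x≡Sg⟧ : ∀ {x : Fin n} → Γ ⊢ Nat x → Γ ⊢ ⟦ var x ≡ᵃ 𝟎 ⟧ᵒ ∨ ∃̇ (Nat zero ∧ ⟦ var (suc x) ≡ᵃ 𝐒 (var zero) ⟧ᵒ)
⟦x≡0∨x≡Sg⟧ {x = x} Nx = ∨E′ (Nat-cases Nx) (λ W₁ ex → let nx = W₁ Nx in ∨I₁ (⟦x≡0⟧ nx ex))
  (λ W₁ G → ∨I₂ (∃E′ {A = Nat zero ∧ zero ∈ˢ suc x ∧ IsSuc zero (suc x)} G λ L₂ h →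
     let nx = L₂ (W₁ Nx) in ∃I zero (∧I (∧E₁ h) (⟦x≡Sg⟧ nx (∧E₁ h) (∧E₂ (∧E₂ h))))))

zeroOrSucc-sound : ∀ {Γ : List (SFm 0)} → Ax Γ →
  Γ ⊢ ⟦ ∀ᵃ (var zero ≡ᵃ 𝟎 ∨ᵃ ∃ᵃ (var (suc zero) ≡ᵃ 𝐒 (var zero))) ⟧ᵒ
zeroOrSucc-sound ax = ∀I′ λ L₁ → ⇒I′ λ W₂ nx → ⟦x≡0∨x≡Sg⟧ nx

AddF-zero : Ax Γ → ∀ {x e : Fin n} → Γ ⊢ Nat x → Γ ⊢ Empty e → Γ ⊢ AddF x e x
AddF-zero ax {x} {e} Nx Ee =
  ∃Eᴬ {A = ∃̇ (IsRec succ (suc (suc x)) (suc (suc e)) (suc zero) zero)} {B = AddF x e x} ax (Addition.recursion ax x e Nx (Nat-Empty Ee)) λ ax₁ L₁ ∃R →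
  ∃Eᴬ {A = IsRec succ (suc (suc x)) (suc (suc e)) (suc zero) zero} {B = AddF (suc x) (suc e) (suc x)} ax₁ ∃R λ ax₂ L₂ R →
  let E2 = L₂ (L₁ Ee) in ∃I (suc zero) (∧I (IsRec-functional R) (∧I (IsRec-base R) (∧I (IsRec-step R) (Addition.BaseClause-elim (IsRec-base R) E2))))

MulF-zero : Ax Γ → ∀ {x e : Fin n} → Γ ⊢ Nat x → Γ ⊢ Empty e → Γ ⊢ MulF x e e
MulF-zero ax {x} {e} Nx Ee =
  ∃Eᴬ {A = ∃̇ (IsRec plus (suc (suc x)) (suc (suc e)) (suc zero) zero)} {B = MulF x e e} ax (Multiplication.recursion ax x e Nx (Nat-Empty Ee)) λ ax₁ L₁ ∃R →
  ∃Eᴬ {A = IsRec plus (suc (suc x)) (suc (suc e)) (suc zero) zero} {B = MulF (suc x) (suc e) (suc e)} ax₁ ∃R λ ax₂ L₂ R →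
  let E2 = L₂ (L₁ Ee) in ∃I (suc zero) (∧I (IsRec-functional R) (∧I (IsRec-base R) (∧I (IsRec-step R) (Multiplication.BaseClause-elim {x = suc (suc x)} (IsRec-base R) E2))))

⟦x+0≡x⟧ : ∀ {x e : Fin n} → Γ ⊢ Nat x → Γ ⊢ Empty e → Γ ⊢ AddF x e x → Γ ⊢ ⟦ var x ⊕ 𝟎 ≡ᵃ var x ⟧ᵒ
⟦x+0≡x⟧ {x = x} {e} Nx Ee A =
  ∃I x (∃I x (∧I Nx (∧I Nx (∧I (∃I x (∃I e (∧I Nx (∧I (Nat-Empty Ee) (∧I (≐refl x) (∧I Ee A))))))
     (∧I (≐refl x) (≐refl x))))))

⟦x·0≡0⟧ : ∀ {x e : Fin n} → Γ ⊢ Nat x → Γ ⊢ Empty e → Γ ⊢ MulF x e e → Γ ⊢ ⟦ var x ⊗ 𝟎 ≡ᵃ 𝟎 ⟧ᵒ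
⟦x·0≡0⟧ {x = x} {e} Nx Ee M =
  ∃I e (∃I e (∧I (Nat-Empty Ee) (∧I (Nat-Empty Ee) (∧I (∃I x (∃I e (∧I Nx (∧I (Nat-Empty Ee) (∧I (≐refl x) (∧I Ee M))))))
     (∧I Ee (≐refl e))))))

addZero-sound : ∀ {Γ : List (SFm 0)} → Ax Γ → Γ ⊢ ⟦ ∀ᵃ (var zero ⊕ 𝟎 ≡ᵃ var zero) ⟧ᵒ
addZero-sound ax = ∀Iᴬ ax λ ax₁ L₁ → ⇒Iᴬ ax₁ λ ax₂ W₂ nx →
  ∃Eᴬ {A = Empty zero} ax₂ (Empty-exists ax₂ zero) λ ax₃ L₃ ee → let nx' = L₃ nx in ⟦x+0≡x⟧ nx' ee (AddF-zero ax₃ nx' ee)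

mulZero-sound : ∀ {Γ : List (SFm 0)} → Ax Γ → Γ ⊢ ⟦ ∀ᵃ (var zero ⊗ 𝟎 ≡ᵃ 𝟎) ⟧ᵒ
mulZero-sound ax = ∀Iᴬ ax λ ax₁ L₁ → ⇒Iᴬ ax₁ λ ax₂ W₂ nx →
  ∃Eᴬ {A = Empty zero} ax₂ (Empty-exists ax₂ zero) λ ax₃ L₃ ee → let nx' = L₃ nx in ⟦x·0≡0⟧ nx' ee (MulF-zero ax₃ nx' ee)

⟦x+Sy≡S[x+y]⟧-witness : ∀ {x y s z z' : Fin n} → Γ ⊢ Nat x → Γ ⊢ Nat y → Γ ⊢ IsSuc y s → Γ ⊢ Nat s → Γ ⊢ Nat z → Γ ⊢ Nat z' →
  Γ ⊢ AddF x y z → Γ ⊢ AddF x s z' → Γ ⊢ IsSuc z z' → Γ ⊢ ⟦ var x ⊕ 𝐒 (var y) ≡ᵃ 𝐒 (var x ⊕ var y) ⟧ᵒ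
⟦x+Sy≡S[x+y]⟧-witness {x = x} {y} {s} {z} {z'} Nx Ny y⁺ Ns Nz Nz' Axy Axs Szz' =
  ∃I z' (∃I z' (∧I Nz' (∧I Nz' (∧I
    (∃I x (∃I s (∧I Nx (∧I Ns (∧I (≐refl x) (∧I (∃I y (∧I Ny (∧I (≐refl y) y⁺))) Axs))))))
    (∧I (∃I z (∧I Nz (∧I (∃I x (∃I y (∧I Nx (∧I Ny (∧I (≐refl x) (∧I (≐refl y) Axy)))))) Szz'))) (≐refl z'))))))

⟦x·Sy≡x·y+x⟧-witness : ∀ {x y s z z' : Fin n} → Γ ⊢ Nat x → Γ ⊢ Nat y → Γ ⊢ IsSuc y s → Γ ⊢ Nat s → Γ ⊢ Nat z → Γ ⊢ Nat z' →
  Γ ⊢ MulF x y z → Γ ⊢ MulF x s z' → Γ ⊢ AddF z x z' → Γ ⊢ ⟦ var x ⊗ 𝐒 (var y) ≡ᵃ var x ⊗ var y ⊕ var x ⟧ᵒ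
⟦x·Sy≡x·y+x⟧-witness {x = x} {y} {s} {z} {z'} Nx Ny y⁺ Ns Nz Nz' Mxy Mxs Azx =
  ∃I z' (∃I z' (∧I Nz' (∧I Nz' (∧I
    (∃I x (∃I s (∧I Nx (∧I Ns (∧I (≐refl x) (∧I (∃I y (∧I Ny (∧I (≐refl y) y⁺))) Mxs))))))
    (∧I (∃I z (∃I x (∧I Nz (∧I Nx (∧I (∃I x (∃I y (∧I Nx (∧I Ny (∧I (≐refl x) (∧I (≐refl y) Mxy)))))) (∧I (≐refl x) Azx))))))
        (≐refl z'))))))

⟦x+Sy≡S[x+y]⟧ : Ax Γ → ∀ {x y s : Fin n} → Γ ⊢ Nat x → Γ ⊢ Nat y → Γ ⊢ IsSuc y s → Γ ⊢ ⟦ var x ⊕ 𝐒 (var y) ≡ᵃ 𝐒 (var x ⊕ var y) ⟧ᵒ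
⟦x+Sy≡S[x+y]⟧ ax {x} {y} {s} Nx Ny y⁺ =
  ∃Eᴬ {A = ∃̇ (Nat (suc zero) ∧ Nat zero ∧ RecFun succ (suc (suc x)) (suc (suc y)) (suc zero) ∧
             RecFun succ (suc (suc x)) (suc (suc s)) zero ∧ StepRel succ (suc (suc x)) (suc zero) zero)} ax (Addition.recursion-succ ax Nx Ny y⁺) λ ax₁ L₁ ∃R →
  ∃Eᴬ {A = Nat (suc zero) ∧ Nat zero ∧ RecFun succ (suc (suc x)) (suc (suc y)) (suc zero) ∧
             RecFun succ (suc (suc x)) (suc (suc s)) zero ∧ StepRel succ (suc (suc x)) (suc zero) zero} ax₁ ∃R λ ax₂ L₂ R →
  let nx = L₂ (L₁ Nx) ; ny = L₂ (L₁ Ny) ; sy = L₂ (L₁ y⁺)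
  in ⟦x+Sy≡S[x+y]⟧-witness nx ny sy (Nat-IsSuc ny sy) (∧E₁ R) (∧E₁ (∧E₂ R)) (∧E₁ (∧E₂ (∧E₂ R))) (∧E₁ (∧E₂ (∧E₂ (∧E₂ R)))) (∧E₂ (∧E₂ (∧E₂ (∧E₂ R))))

⟦x·Sy≡x·y+x⟧ : Ax Γ → ∀ {x y s : Fin n} → Γ ⊢ Nat x → Γ ⊢ Nat y → Γ ⊢ IsSuc y s → Γ ⊢ ⟦ var x ⊗ 𝐒 (var y) ≡ᵃ var x ⊗ var y ⊕ var x ⟧ᵒ
⟦x·Sy≡x·y+x⟧ ax {x} {y} {s} Nx Ny y⁺ =
  ∃Eᴬ {A = ∃̇ (Nat (suc zero) ∧ Nat zero ∧ RecFun plus (suc (suc x)) (suc (suc y)) (suc zero) ∧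
             RecFun plus (suc (suc x)) (suc (suc s)) zero ∧ StepRel plus (suc (suc x)) (suc zero) zero)} ax (Multiplication.recursion-succ ax Nx Ny y⁺) λ ax₁ L₁ ∃R →
  ∃Eᴬ {A = Nat (suc zero) ∧ Nat zero ∧ RecFun plus (suc (suc x)) (suc (suc y)) (suc zero) ∧
             RecFun plus (suc (suc x)) (suc (suc s)) zero ∧ StepRel plus (suc (suc x)) (suc zero) zero} ax₁ ∃R λ ax₂ L₂ R →
  let nx = L₂ (L₁ Nx) ; ny = L₂ (L₁ Ny) ; sy = L₂ (L₁ y⁺)
  in ⟦x·Sy≡x·y+x⟧-witness nx ny sy (Nat-IsSuc ny sy) (∧E₁ R) (∧E₁ (∧E₂ R)) (∧E₁ (∧E₂ (∧E₂ R))) (∧E₁ (∧E₂ (∧E₂ (∧E₂ R)))) (∧E₂ (∧E₂ (∧E₂ (∧E₂ R))))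

addSucc-sound : ∀ {Γ : List (SFm 0)} → Ax Γ →
  Γ ⊢ ⟦ ∀ᵃ (∀ᵃ (var (suc zero) ⊕ 𝐒 (var zero) ≡ᵃ 𝐒 (var (suc zero) ⊕ var zero))) ⟧ᵒ
addSucc-sound ax = ∀Iᴬ ax λ ax₁ L₁ → ⇒Iᴬ ax₁ λ ax₂ W₂ nx → ∀Iᴬ ax₂ λ ax₃ L₃ → ⇒Iᴬ ax₃ λ ax₄ W₄ ny →
  let nx' = W₄ (L₃ nx) in ∃Eᴬ {A = IsSuc (suc zero) zero} ax₄ (IsSuc-exists ax₄ zero) λ ax₅ L₅ sy →
  let nx'' = L₅ nx' ; ny' = L₅ ny in ⟦x+Sy≡S[x+y]⟧ ax₅ nx'' ny' sy

mulSucc-sound : ∀ {Γ : List (SFm 0)} → Ax Γ →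
  Γ ⊢ ⟦ ∀ᵃ (∀ᵃ (var (suc zero) ⊗ 𝐒 (var zero) ≡ᵃ var (suc zero) ⊗ var zero ⊕ var (suc zero))) ⟧ᵒ
mulSucc-sound ax = ∀Iᴬ ax λ ax₁ L₁ → ⇒Iᴬ ax₁ λ ax₂ W₂ nx → ∀Iᴬ ax₂ λ ax₃ L₃ → ⇒Iᴬ ax₃ λ ax₄ W₄ ny →
  let nx' = W₄ (L₃ nx) in ∃Eᴬ {A = IsSuc (suc zero) zero} ax₄ (IsSuc-exists ax₄ zero) λ ax₅ L₅ sy →
  let nx'' = L₅ nx' ; ny' = L₅ ny in ⟦x·Sy≡x·y+x⟧ ax₅ nx'' ny' sy

ren-TmIs : (π : Fin m → Fin k) (ρ : Fin n → Fin m) → ∀ t y → ren π (TmIs ρ t y) ≡ TmIs (π ∘′ ρ) t (π y)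
ren-TmIs π ρ (var i) y = refl
ren-TmIs π ρ 𝟎 y = refl
ren-TmIs π ρ (𝐒 t) y = cong (λ X → ∃̇ (Nat zero ∧ X ∧ IsSuc zero (suc (π y)))) (ren-TmIs (ext π) (suc ∘′ ρ) t zero)
ren-TmIs π ρ (t ⊕ s) y = cong₂ (λ A B → ∃̇ (∃̇ (Nat (suc zero) ∧ Nat zero ∧ A ∧ B ∧ AddF (suc zero) zero (suc (suc (π y))))))
  (ren-TmIs (ext (ext π)) (suc ∘′ suc ∘′ ρ) t (suc zero)) (ren-TmIs (ext (ext π)) (suc ∘′ suc ∘′ ρ) s zero)
ren-TmIs π ρ (t ⊗ s) y = cong₂ (λ A B → ∃̇ (∃̇ (Nat (suc zero) ∧ Nat zero ∧ A ∧ B ∧ MulF (suc zero) zero (suc (suc (π y))))))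
  (ren-TmIs (ext (ext π)) (suc ∘′ suc ∘′ ρ) t (suc zero)) (ren-TmIs (ext (ext π)) (suc ∘′ suc ∘′ ρ) s zero)

TmIs-renT : (ρ : Fin m → Fin k) (τ : Fin n → Fin m) → ∀ t y → TmIs ρ (renT τ t) y ≡ TmIs (ρ ∘′ τ) t y
TmIs-renT ρ τ (var i) y = refl
TmIs-renT ρ τ 𝟎 y = refl
TmIs-renT ρ τ (𝐒 t) y = cong (λ X → ∃̇ (Nat zero ∧ X ∧ IsSuc zero (suc y))) (TmIs-renT (suc ∘′ ρ) τ t zero)
TmIs-renT ρ τ (t ⊕ s) y = cong₂ (λ A B → ∃̇ (∃̇ (Nat (suc zero) ∧ Nat zero ∧ A ∧ B ∧ AddF (suc zero) zero (suc (suc y)))))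
  (TmIs-renT (suc ∘′ suc ∘′ ρ) τ t (suc zero)) (TmIs-renT (suc ∘′ suc ∘′ ρ) τ s zero)
TmIs-renT ρ τ (t ⊗ s) y = cong₂ (λ A B → ∃̇ (∃̇ (Nat (suc zero) ∧ Nat zero ∧ A ∧ B ∧ MulF (suc zero) zero (suc (suc y)))))
  (TmIs-renT (suc ∘′ suc ∘′ ρ) τ t (suc zero)) (TmIs-renT (suc ∘′ suc ∘′ ρ) τ s zero)

⟦≡⟧-under : (Fin n → Fin m) → ATm n → ATm n → SFm m
⟦≡⟧-under π t s = ∃̇ (∃̇ (Nat (suc zero) ∧ Nat zero ∧ TmIs (suc ∘′ suc ∘′ π) t (suc zero) ∧
                         TmIs (suc ∘′ suc ∘′ π) s zero ∧ suc zero ≐ zero))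

ren-⟦≡⟧ : (π : Fin n → Fin m) → ∀ t s → ren π ⟦ t ≡ᵃ s ⟧ᵒ ≡ ⟦≡⟧-under π t s
ren-⟦≡⟧ π t s = cong₂ (λ A B → ∃̇ (∃̇ (Nat (suc zero) ∧ Nat zero ∧ A ∧ B ∧ suc zero ≐ zero)))
  (ren-TmIs (ext (ext π)) (suc ∘′ suc) t (suc zero)) (ren-TmIs (ext (ext π)) (suc ∘′ suc) s zero)

inst-ext-wk : (B : SFm (suc n)) → ren (inst zero) (ren (ext suc) B) ≡ B
inst-ext-wk B = trans (ren-∘ _ _ B) (ren-id (λ { zero → refl ; (suc i) → refl }) B)

⇔-refl : Γ ⊢ A ⇔ A
⇔-refl = ∧I (⇒I hyp₀) (⇒I hyp₀)

∧-cong : {A′ B′ : SFm n} → Γ ⊢ A ⇔ A′ → Γ ⊢ B ⇔ B′ → Γ ⊢ (A ∧ B) ⇔ (A′ ∧ B′)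
∧-cong p q = ∧I (⇒I (∧I (⇔E₁ (⊢∷ p) (∧E₁ hyp₀)) (⇔E₁ (⊢∷ q) (∧E₂ hyp₀))))
                (⇒I (∧I (⇔E₂ (⊢∷ p) (∧E₁ hyp₀)) (⇔E₂ (⊢∷ q) (∧E₂ hyp₀))))

∨-cong : {A′ B′ : SFm n} → Γ ⊢ A ⇔ A′ → Γ ⊢ B ⇔ B′ → Γ ⊢ (A ∨ B) ⇔ (A′ ∨ B′)
∨-cong p q = ∧I (⇒I (∨E hyp₀ (∨I₁ (⇔E₁ (⊢∷∷ p) hyp₀)) (∨I₂ (⇔E₁ (⊢∷∷ q) hyp₀))))
                (⇒I (∨E hyp₀ (∨I₁ (⇔E₂ (⊢∷∷ p) hyp₀)) (∨I₂ (⇔E₂ (⊢∷∷ q) hyp₀))))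

⇒-cong : {A′ B′ : SFm n} → Γ ⊢ A ⇔ A′ → Γ ⊢ B ⇔ B′ → Γ ⊢ (A ⇒ B) ⇔ (A′ ⇒ B′)
⇒-cong p q = ∧I (⇒I (⇒I (⇔E₁ (⊢∷∷ q) (⇒E hyp₁ (⇔E₂ (⊢∷∷ p) hyp₀)))))
                (⇒I (⇒I (⇔E₂ (⊢∷∷ q) (⇒E hyp₁ (⇔E₁ (⊢∷∷ p) hyp₀)))))

∃-cong : {A B : SFm (suc n)} → map wk Γ ⊢ A ⇔ B → Γ ⊢ ∃̇ A ⇔ ∃̇ B
∃-cong {A = A} {B} p =
  ∧I (⇒I (∃E hyp₀ (∃I zero (⊢-cast (sym (inst-ext-wk B)) (⇔E₁ (⊢∷∷ p) hyp₀)))))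
     (⇒I (∃E hyp₀ (∃I zero (⊢-cast (sym (inst-ext-wk A)) (⇔E₂ (⊢∷∷ p) hyp₀)))))

∀-cong : {A B : SFm (suc n)} → map wk Γ ⊢ A ⇔ B → Γ ⊢ ∀̇ A ⇔ ∀̇ B
∀-cong {Γ = Γ} {A = A} {B} p =
  ∧I (⇒I (∀I (⇔E₁ (⊢∷ p) (⊢-cast (inst-ext-wk A) (∀E (⊢wk hyp₀) zero)))))
     (⇒I (∀I (⇔E₂ (⊢∷ p) (⊢-cast (inst-ext-wk B) (∀E (⊢wk hyp₀) zero)))))

Denotes : (Fin n → ATm k) → (Fin k → Fin m) → (Fin n → Fin m) → List (SFm m) → Set
Denotes {m = m} σ π τ Δ = ∀ i {m′} {Δ′ : List (SFm m′)} (ρ : Fin m → Fin m′) → Embedding ρ Δ Δ′ → ∀ y →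
  Δ′ ⊢ TmIs (ρ ∘′ π) (σ i) y ⇔ y ≐ ρ (τ i)

TmIs-subT : (t : ATm n) (σ : Fin n → ATm k) (π : Fin k → Fin m) (τ : Fin n → Fin m) {Δ : List (SFm m)} →
  Denotes σ π τ Δ → ∀ {m′} {Δ′ : List (SFm m′)} (ρ : Fin m → Fin m′) → Embedding ρ Δ Δ′ → ∀ y →
  Δ′ ⊢ TmIs (ρ ∘′ π) (subT σ t) y ⇔ TmIs (ρ ∘′ τ) t y
TmIs-subT (var i) σ π τ D ρ e y = D i ρ e y
TmIs-subT 𝟎 σ π τ D ρ e y = ⇔-refl
TmIs-subT (𝐒 t) σ π τ D ρ e y =
  ∃-cong (∧-cong ⇔-refl (∧-cong (TmIs-subT t σ π τ D (suc ∘′ ρ) (Embedding-wk e) zero) ⇔-refl))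
TmIs-subT (t ⊕ s) σ π τ D ρ e y = ∃-cong (∃-cong (∧-cong ⇔-refl (∧-cong ⇔-refl
  (∧-cong (TmIs-subT t σ π τ D (suc ∘′ suc ∘′ ρ) (Embedding-wk (Embedding-wk e)) (suc zero))
          (∧-cong (TmIs-subT s σ π τ D (suc ∘′ suc ∘′ ρ) (Embedding-wk (Embedding-wk e)) zero) ⇔-refl)))))
TmIs-subT (t ⊗ s) σ π τ D ρ e y = ∃-cong (∃-cong (∧-cong ⇔-refl (∧-cong ⇔-refl
  (∧-cong (TmIs-subT t σ π τ D (suc ∘′ suc ∘′ ρ) (Embedding-wk (Embedding-wk e)) (suc zero))
          (∧-cong (TmIs-subT s σ π τ D (suc ∘′ suc ∘′ ρ) (Embedding-wk (Embedding-wk e)) zero) ⇔-refl)))))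

Denotes-ext : {σ : Fin n → ATm k} {π : Fin k → Fin m} {τ : Fin n → Fin m} {Δ : List (SFm m)} →
  Denotes σ π τ Δ → Denotes (extT σ) (ext π) (ext τ) (map wk Δ)
Denotes-ext D zero ρ e y = ⇔-refl
Denotes-ext {σ = σ} {π = π} D (suc i) {Δ′ = Δ′} ρ e y =
  subst (λ X → Δ′ ⊢ X ⇔ _) (sym (TmIs-renT (ρ ∘′ ext π) suc (σ i) y)) (D i (ρ ∘′ suc) (Embedding-unwk e) y)

⟦subA⟧-⇔ : (φ : AFm n) (σ : Fin n → ATm k) (π : Fin k → Fin m) (τ : Fin n → Fin m) {Δ : List (SFm m)} →
  Ax Δ → Denotes σ π τ Δ → Δ ⊢ ren π ⟦ subA σ φ ⟧ᵒ ⇔ ren τ ⟦ φ ⟧ᵒ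
⟦subA⟧-⇔ (t ≡ᵃ s) σ π τ {Δ} ax D =
  subst₂ (λ X Y → Δ ⊢ X ⇔ Y) (sym (ren-⟦≡⟧ π (subT σ t) (subT σ s))) (sym (ren-⟦≡⟧ τ t s))
    (∃-cong (∃-cong (∧-cong ⇔-refl (∧-cong ⇔-refl
      (∧-cong (TmIs-subT t σ π τ D (suc ∘′ suc) e (suc zero))
              (∧-cong (TmIs-subT s σ π τ D (suc ∘′ suc) e zero) ⇔-refl))))))
  where
  e = Embedding-wk (Embedding-wk (Embedding-refl ax))
⟦subA⟧-⇔ ⊥ᵃ σ π τ ax D = ⇔-refl
⟦subA⟧-⇔ (φ ∧ᵃ ψ) σ π τ ax D = ∧-cong (⟦subA⟧-⇔ φ σ π τ ax D) (⟦subA⟧-⇔ ψ σ π τ ax D)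
⟦subA⟧-⇔ (φ ∨ᵃ ψ) σ π τ ax D = ∨-cong (⟦subA⟧-⇔ φ σ π τ ax D) (⟦subA⟧-⇔ ψ σ π τ ax D)
⟦subA⟧-⇔ (φ ⇒ᵃ ψ) σ π τ ax D = ⇒-cong (⟦subA⟧-⇔ φ σ π τ ax D) (⟦subA⟧-⇔ ψ σ π τ ax D)
⟦subA⟧-⇔ (∀ᵃ φ) σ π τ ax D = ∀-cong (⇒-cong ⇔-refl (⟦subA⟧-⇔ φ (extT σ) (ext π) (ext τ) (Ax-wk ax) (Denotes-ext D)))
⟦subA⟧-⇔ (∃ᵃ φ) σ π τ ax D = ∃-cong (∧-cong ⇔-refl (⟦subA⟧-⇔ φ (extT σ) (ext π) (ext τ) (Ax-wk ax) (Denotes-ext D)))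

σZero-denotes : {Δ : List (SFm (suc n))} → Denotes σZero suc id (Empty zero ∷ Δ)
σZero-denotes zero ρ (ax , tr) y =
  ∧I (⇒I (Empty-unique (Ax-∷ ax) hyp₀ (⊢∷ (tr hyp₀)))) (⇒I (≐subst (Empty zero) (≐sym hyp₀) (⊢∷ (tr hyp₀))))
σZero-denotes (suc i) ρ e y = ⇔-refl

σSucc-denotes : {Δ : List (SFm (suc (suc n)))} →
  Denotes σSucc indRen suc ((Nat zero ∧ zero ∈ˢ suc zero ∧ IsSuc zero (suc zero)) ∷ Δ)
σSucc-denotes zero ρ (ax , tr) y =
  ∧I (⇒I (∃E hyp₀ (≐sym (IsSuc-unique (Ax-wk∷ (Ax-∷ ax)) (∧E₂ (∧E₂ (⊢wk∷ (⊢∷ (tr hyp₀)))))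
                   (≐subst (IsSuc zero (suc (suc y))) (∧E₁ (∧E₂ hyp₀)) (∧E₂ (∧E₂ hyp₀)))))))
     (⇒I (∃I (ρ zero) (∧I (∧E₁ (⊢∷ (tr hyp₀))) (∧I (≐refl (ρ zero))
          (≐subst (IsSuc (suc (ρ zero)) zero) (≐sym hyp₀) (∧E₂ (∧E₂ (⊢∷ (tr hyp₀)))))))))
σSucc-denotes (suc i) ρ e y = ⇔-refl

ext-suc≗indRen : (i : Fin (suc n)) → ext suc i ≡ indRen i
ext-suc≗indRen zero    = refl
ext-suc≗indRen (suc i) = refl

inst-ext-wk² : (X : SFm (suc n)) → ren (inst zero) (ren (ext suc) (ren (ext suc) X)) ≡ ren indRen X
inst-ext-wk² X = trans (inst-ext-wk (ren (ext suc) X)) (ren-cong ext-suc≗indRen X)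

induction-sound : (φ : AFm (suc n)) → Ax Γ → Γ ⊢ ren emb (closeS (SetInduction (Nat zero ⇒ ⟦ φ ⟧ᵒ))) →
  Γ ⊢ ⟦ (subA σZero φ ∧ᵃ ∀ᵃ (φ ⇒ᵃ subA σSucc φ)) ⇒ᵃ ∀ᵃ φ ⟧ᵒ
induction-sound {n = n} {Γ = Γ} φ ax SI =
  ⇒I (⇒E set-induction (∀I (⇒I (⇒I (∨E (Nat-cases hyp₀) zero-case (∃E hyp₀ succ-case))))))
  where
  H : SFm n
  H = ⟦ subA σZero φ ∧ᵃ ∀ᵃ (φ ⇒ᵃ subA σSucc φ) ⟧ᵒ
  ψ : SFm (suc n)
  ψ = Nat zero ⇒ ⟦ φ ⟧ᵒ
  set-induction : H ∷ Γ ⊢ SetInduction ψ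
  set-induction = ⊢-cast (ren-id (λ _ → refl) (SetInduction ψ)) (closeS-elim (SetInduction ψ) id (⊢∷ SI))
  Θ : List (SFm (suc n))
  Θ = Nat zero ∷ ∀̇ (zero ∈ˢ suc zero ⇒ ren indRen ψ) ∷ map wk (H ∷ Γ)
  ax-Θ : Ax Θ
  ax-Θ = Ax-∷ (Ax-∷ (Ax-wk (Ax-∷ ax)))
  zero-case : Empty zero ∷ Θ ⊢ ⟦ φ ⟧ᵒ
  zero-case = ⊢-cast (ren-id (λ _ → refl) ⟦ φ ⟧ᵒ)
    (⇔E₁ (⟦subA⟧-⇔ φ σZero suc id (Ax-∷ ax-Θ) σZero-denotes) (∧E₁ (⊢∷ (⊢∷∷ (⊢wk hyp₀)))))
  Θ⁺ : List (SFm (suc (suc n)))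
  Θ⁺ = (Nat zero ∧ zero ∈ˢ suc zero ∧ IsSuc zero (suc zero)) ∷ map wk (∃̇ (Nat zero ∧ zero ∈ˢ suc zero ∧ IsSuc zero (suc zero)) ∷ Θ)
  φ[g] : Θ⁺ ⊢ ren indRen ⟦ φ ⟧ᵒ
  φ[g] = ⊢-cast (inst-ext-wk (ren indRen ⟦ φ ⟧ᵒ))
    (⇒E (⇒E (∀E (⊢wk∷ (hyp₂ {Γ = map wk (H ∷ Γ)})) zero) (∧E₁ (∧E₂ hyp₀))) (∧E₁ hyp₀))
  φ[Sg] : Θ⁺ ⊢ ren indRen ⟦ subA σSucc φ ⟧ᵒ
  φ[Sg] = ⊢-cast (inst-ext-wk² _)
    (⇒E (⇒E (∀E (∧E₂ (⊢wk∷ (⊢∷ (⊢∷∷ (⊢wk (hyp₀ {Γ = Γ})))))) zero) (∧E₁ hyp₀))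
        (⊢-cast (sym (inst-ext-wk² ⟦ φ ⟧ᵒ)) φ[g]))
  succ-case : Θ⁺ ⊢ wk ⟦ φ ⟧ᵒ
  succ-case = ⇔E₁ (⟦subA⟧-⇔ φ σSucc indRen suc (Ax-wk∷ (Ax-∷ ax-Θ)) σSucc-denotes) φ[Sg]

⟦closeA⟧-intro : (χ : AFm n) (α : SFm 0) →
  (∀ {Γ : List (SFm n)} → Ax Γ → Γ ⊢ ren emb α → Γ ⊢ ⟦ χ ⟧ᵒ) →
  ∀ {Γ : List (SFm 0)} → Ax Γ → Γ ⊢ ren emb α → Γ ⊢ ⟦ closeA χ ⟧ᵒ
⟦closeA⟧-intro {zero} χ α P ax d = P ax d
⟦closeA⟧-intro {suc n} χ α P ax d =
  ⟦closeA⟧-intro (∀ᵃ χ) α (λ ax′ d′ → ∀I (⇒I (P (Ax-∷ (Ax-wk ax′)) (⊢∷ (⊢-cast (ren-emb-closed suc α) (⊢wk d′))))))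
    ax d

axioms-TAx : All TAx axioms
axioms-TAx = extensionality ∷ pairing ∷ union ∷ intersection ∷ setInduction irreflexivityF
  ∷ setInduction (recursionF succ) ∷ setInduction (recursionF plus) ∷ setInduction agreementF ∷ []

Ax-⊆ : {Λ : List (SFm 0)} → axioms ⊆ Λ → Ax (map (ren (emb {0})) Λ)
Ax-⊆ s α∈ = hyp (∈-map⁺ (ren emb) (s α∈))

⊢ᵀ-intro : {σ : SFm 0} (Λ : List (SFm 0)) → All TAx Λ → map (ren (emb {0})) Λ ⊢ σ → TAx ⊢ᵀ σ
⊢ᵀ-intro {σ = σ} Λ tax d = 0 , Λ , tax , ⊢-cast (sym (ren-id (λ ()) σ)) d

mainTheorem18 : (σ : AFm 0) → HAAx σ → TAx ⊢ᵀ ⟦ σ ⟧ᵒ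
mainTheorem18 _ succInj    = ⊢ᵀ-intro axioms axioms-TAx (succInj-sound (Ax-⊆ ⊆-refl))
mainTheorem18 _ zeroOrSucc = ⊢ᵀ-intro axioms axioms-TAx (zeroOrSucc-sound (Ax-⊆ ⊆-refl))
mainTheorem18 _ addZero    = ⊢ᵀ-intro axioms axioms-TAx (addZero-sound (Ax-⊆ ⊆-refl))
mainTheorem18 _ addSucc    = ⊢ᵀ-intro axioms axioms-TAx (addSucc-sound (Ax-⊆ ⊆-refl))
mainTheorem18 _ mulZero    = ⊢ᵀ-intro axioms axioms-TAx (mulZero-sound (Ax-⊆ ⊆-refl))
mainTheorem18 _ mulSucc    = ⊢ᵀ-intro axioms axioms-TAx (mulSucc-sound (Ax-⊆ ⊆-refl))
mainTheorem18 _ (induction φ) =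
  ⊢ᵀ-intro (SI ∷ axioms) (setInduction (Nat zero ⇒ ⟦ φ ⟧ᵒ) ∷ axioms-TAx)
    (⟦closeA⟧-intro _ SI (induction-sound φ) (Ax-⊆ (xs⊆x∷xs axioms SI)) (hyp (here refl)))
  where
  SI = closeS (SetInduction (Nat zero ⇒ ⟦ φ ⟧ᵒ))
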